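{- For every positive integer $n$, the polynomials $\mathsf{ADerExc}_n(t)$, $\mathsf{ADerExc}_n^{+}(t)$ and $\mathsf{ADerExc}_n^{ - }(t)$ are gamma positive with center of symmetry $n/2$.
   Context: $\mathfrak{S}_n$ is the symmetric group on $[n]$, $\mathcal{A}_n$ its even permutations, $\mathfrak{SD}_n=\{\pi\in\mathfrak{S}_n:\pi_i\ne i\ \forall i\}$ the derangements, $\mathfrak{SD}_n^{+}=\mathfrak{SD}_n\cap\mathcal{A}_n$, $\mathfrak{SD}_n^{ - }=\mathfrak{SD}_n\setminus\mathcal{A}_n$. $\mathsf{exc}(\pi)=|\{i:\pi_i>i\}|$. $\mathsf{ADerExc}_n(t)=\sum_{\pi\in\mathfrak{SD}_n}t^{\mathsf{exc}(\pi)}$ and $\mathsf{ADerExc}_n^{\pm}(t)=\sum_{\pi\in\mathfrak{SD}_n^{\pm}}t^{\mathsf{exc}(\pi)}$. A polynomial $f(t)$ is gamma positive with center of symmetry $c$ ($2c\in\mathbb{Z}$) if $f(t)=\sum_{j}\gamma_jt^j(1+t)^{2c-2j}$, summing over integers $j$ with $0\le j\le c$, with all $\gamma_j\ge0$. -}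

module Defs where

open import Data.Nat using (ℕ; zero; suc; _+_; _*_; _∸_; _<_; _≤_; _<?_; _≤?_)
open import Data.Nat.Properties using (_≟_)
open import Data.Nat.DivMod using (_/_; _%_)
open import Data.Nat.Combinatorics using (_C_)
open import Data.Fin using (Fin; toℕ)
import Data.Fin.Properties as FinP
open import Data.Vec using (Vec; []; _∷_; lookup; toList)
open import Data.List using (List; []; _∷_; [_]; map; concatMap; filter; length; upTo; allFin)
open import Data.Nat.ListAction using (sum)
open import Data.List.Relation.Unary.Unique.Propositional using (Unique)
import Data.List.Relation.Unary.Unique.DecPropositional as UDec
open import Relation.Binary.PropositionalEquality using (_≡_; _≢_)
open import Relation.Nullary using (¬_; Dec; yes; no)
open import Relation.Nullary.Decidable using (¬?)
open import Data.Product using (∃)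

allVecs : (n m : ℕ) → List (Vec (Fin n) m)
allVecs n zero    = [ [] ]
allVecs n (suc m) = concatMap (λ x → map (x ∷_) (allVecs n m)) (allFin n)

-- A permutation of [n] (0-based: Fin n) in one-line notation π = π₀ π₁ … π_{n-1}
-- is a word of length n over Fin n with pairwise distinct letters.
IsPerm : {n : ℕ} → Vec (Fin n) n → Set
IsPerm v = Unique (toList v)

isPerm? : {n : ℕ} (v : Vec (Fin n) n) → Dec (IsPerm v)
isPerm? v = UDec.unique? FinP._≟_ (toList v)

𝔖 : (n : ℕ) → List (Vec (Fin n) n)
𝔖 n = filter isPerm? (allVecs n n)

IsDerangement : {n : ℕ} → Vec (Fin n) n → Set
IsDerangement {n} v = (i : Fin n) → lookup v i ≢ i

isDerangement? : {n : ℕ} (v : Vec (Fin n) n) → Dec (IsDerangement v)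
isDerangement? v = FinP.all? (λ i → ¬? (lookup v i FinP.≟ i))

inv : {n : ℕ} → Vec (Fin n) n → ℕ
inv {n} v = length (filter (λ ij → toℕ (lookup v (Data.Product.proj₂ ij)) <? toℕ (lookup v (Data.Product.proj₁ ij)))
                  (filter (λ ij → toℕ (Data.Product.proj₁ ij) <? toℕ (Data.Product.proj₂ ij))
                     (concatMap (λ i → map (λ j → i Data.Product., j) (allFin n)) (allFin n))))

IsEven : {n : ℕ} → Vec (Fin n) n → Set
IsEven v = inv v % 2 ≡ 0

isEven? : {n : ℕ} (v : Vec (Fin n) n) → Dec (IsEven v)
isEven? v = (inv v % 2) ≟ 0

-- Excedances: i with π_i > i (shifting to 1-based indexing does not change this).
exc : {n : ℕ} → Vec (Fin n) n → ℕ
exc {n} v = length (filter (λ i → toℕ i <? toℕ (lookup v i)) (allFin n))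

SD : (n : ℕ) → List (Vec (Fin n) n)
SD n = filter isDerangement? (𝔖 n)

SD⁺ : (n : ℕ) → List (Vec (Fin n) n)
SD⁺ n = filter isEven? (SD n)

SD⁻ : (n : ℕ) → List (Vec (Fin n) n)
SD⁻ n = filter (λ v → ¬? (isEven? v)) (SD n)

-- A polynomial with natural-number coefficients is represented by its
-- coefficient function: (coeff k) = [t^k] of the polynomial.
excPoly : {n : ℕ} → List (Vec (Fin n) n) → ℕ → ℕ
excPoly L k = length (filter (λ v → exc v ≟ k) L)

ADerExc ADerExc⁺ ADerExc⁻ : ℕ → ℕ → ℕ
ADerExc  n = excPoly (SD n)
ADerExc⁺ n = excPoly (SD⁺ n)
ADerExc⁻ n = excPoly (SD⁻ n)

-- [t^k] of t^j (1+t)^m  =  C(m, k-j) if j ≤ k, else 0.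
coeffGammaBasis : (j m k : ℕ) → ℕ
coeffGammaBasis j m k with j ≤? k
... | yes _ = m C (k ∸ j)
... | no  _ = 0

-- f is gamma positive with center of symmetry c, where twoC = 2c:
-- f(t) = Σ_{j=0}^{⌊c⌋} γ_j t^j (1+t)^{2c-2j} with all γ_j ≥ 0,
-- compared coefficientwise (for every k).
GammaPositive : (f : ℕ → ℕ) (twoC : ℕ) → Set
GammaPositive f twoC =
  ∃ λ (γ : ℕ → ℕ) → (k : ℕ) →
    f k ≡ sum (map (λ j → γ j * coeffGammaBasis j (twoC ∸ 2 * j) k) (upTo (suc (twoC / 2))))

-- Write D(n,p,k) for the number of derangements of [n] with k excedances whose
-- evenness is p.  The proof has two halves.
--
-- Combinatorial half: D satisfies, for the opposite parity q = ¬p,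
--   D(N+2,p,k+1) = (k+1) D(N+1,q,k+1) + (N+1-k) D(N+1,q,k) + (N+1) D(N,q,k).
-- A derangement π of [N+2] with π(0) = b+1 corresponds to the pair (b, σ) where
-- σ ∈ 𝔖_{N+1} is obtained by contracting 0 out of its cycle.  σ can only fix b,
-- π has the opposite parity, and exc π = 1 + #(excedances of σ with value ≠ b).
-- If σ is a derangement, summing over the N+1 choices of b gives the first two
-- terms; if σ fixes b, deleting b gives a derangement of [N] and the third term.
--
-- Algebraic half: any family satisfying this recurrence and the initial values
-- of D is a nonnegative combination Σ_j γ_{n,p}(j) t^j (1+t)^(n-2j), with γ
-- defined by a recurrence of the same shape (`GammaExpansion`); the key identity
-- is how the operator f(k) ↦ (k+1)f(k+1) + (n-k)f(k) acts on t^j(1+t)^m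
-- (`basis-step`).  The theorem follows by adding the two parities.
module Submission where

open import Data.Nat using (ℕ; zero; suc; _+_; _*_; _∸_; _<_; _≤_; _<?_; _≤?_; z≤n; s≤s; _%_; s≤s⁻¹; s<s⁻¹; _/_)
open import Data.Nat.Properties
open import Data.Bool using (Bool; true; false; not)
open import Data.Fin using (Fin; zero; suc; toℕ; punchIn; punchOut)
open import Data.Product using (_×_; _,_; proj₁; proj₂; ∃)
open import Data.Sum using (_⊎_; inj₁; inj₂)
open import Data.Empty using (⊥; ⊥-elim)
open import Relation.Nullary using (¬_; Dec; yes; no; does)
open import Relation.Binary.Definitions using (DecidableEquality; tri<; tri≈; tri>)
open import Relation.Binary.PropositionalEquality
open import Data.Vec using (Vec; []; _∷_; lookup; toList; insertAt; tabulate)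
open import Data.List using (List; []; _∷_; filter; length; concatMap; allFin; _++_; applyUpTo; map)
open import Relation.Unary using (Decidable)
open import Defs
open import Data.List.Relation.Unary.All using (All; []; _∷_)
open import Data.List.Relation.Unary.AllPairs using ([]; _∷_)
open import Relation.Nullary.Decidable using (¬?; _×-dec_; decidable-stable)
open import Data.List.Relation.Unary.Unique.Propositional using (Unique)
open import Data.Nat.DivMod using ([m+kn]%n≡m%n; m%n<n; m≡m%n+[m/n]*n)
open import Data.Nat.Combinatorics using (nCk+nC[k+1]≡[n+1]C[k+1]; k>n⇒nCk≡0)
import Data.Nat.Combinatorics as Comb
open import Data.Nat.Tactic.RingSolver
open import Data.Nat.ListAction using (sum)
import Data.Fin.Properties as FinP
import Data.Vec.Properties as VecP
import Data.List as L
import Data.Vec as V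
open ≡-Reasoning

ind : ∀ {p} {P : Set p} → Dec P → ℕ
ind (yes _) = 1
ind (no _) = 0

ind-iff : ∀ {p q} {P : Set p} {Q : Set q} (d : Dec P) (e : Dec Q) → (P → Q) → (Q → P) → ind d ≡ ind e
ind-iff (yes _) (yes _) f g = refl
ind-iff (yes p) (no ¬q) f g = ⊥-elim (¬q (f p))
ind-iff (no ¬p) (yes q) f g = ⊥-elim (¬p (g q))
ind-iff (no _) (no _) f g = refl

ind-yes : ∀ {p} {P : Set p} (d : Dec P) → P → ind d ≡ 1
ind-yes (yes _) _ = refl
ind-yes (no ¬p) p = ⊥-elim (¬p p)

ind-no : ∀ {p} {P : Set p} (d : Dec P) → ¬ P → ind d ≡ 0
ind-no (yes p) ¬p = ⊥-elim (¬p p)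
ind-no (no _) _ = refl

ind≤1 : ∀ {p} {P : Set p} (d : Dec P) → ind d ≤ 1
ind≤1 (yes _) = s≤s z≤n
ind≤1 (no _) = z≤n

ind¬+ind : ∀ {p} {P : Set p} (d : Dec P) → ind (¬? d) + ind d ≡ 1
ind¬+ind (yes _) = refl
ind¬+ind (no _) = refl

bit : Bool → ℕ
bit true = 1
bit false = 0

ind-bit : ∀ {p} {P : Set p} (d : Dec P) → ind d ≡ bit (does d)
ind-bit (yes _) = refl
ind-bit (no _) = refl

ind-¬ : ∀ {p} {P : Set p} (d : Dec P) → ind (¬? d) ≡ bit (not (does d))
ind-¬ (yes _) = refl
ind-¬ (no _) = refl

record LinearSum (A : Set) : Set₁ where
  field
    S : (A → ℕ) → ℕ
    S-cong : ∀ {f g : A → ℕ} → (∀ a → f a ≡ g a) → S f ≡ S g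
    S-+ : ∀ (f g : A → ℕ) → S (λ a → f a + g a) ≡ S f + S g
    S-0 : S (λ _ → 0) ≡ 0

module LinearSumProps {A : Set} (L : LinearSum A) where
  open LinearSum L
  S-zero : ∀ {f : A → ℕ} → (∀ a → f a ≡ 0) → S f ≡ 0
  S-zero h = trans (S-cong h) S-0

  S-scal : ∀ c (f : A → ℕ) → S (λ a → c * f a) ≡ c * S f
  S-scal zero f = S-0
  S-scal (suc c) f = trans (S-+ f (λ a → c * f a)) (cong (S f +_) (S-scal c f))

  S-scalʳ : ∀ c (f : A → ℕ) → S (λ a → f a * c) ≡ S f * c
  S-scalʳ c f = trans (S-cong (λ a → *-comm (f a) c)) (trans (S-scal c f) (*-comm c (S f)))

record Summation (A : Set) : Set₁ where
  field
    lin : LinearSum A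
    comm : ∀ {B : Set} (T : LinearSum B) (h : A → B → ℕ) →
      LinearSum.S lin (λ a → LinearSum.S T (h a)) ≡ LinearSum.S T (λ b → LinearSum.S lin (λ a → h a b))
    deq : DecidableEquality A
    delta : ∀ c → LinearSum.S lin (λ a → ind (deq a c)) ≡ 1
  open LinearSum lin public
  open LinearSumProps lin public

  delta-f : ∀ c (f : A → ℕ) → S (λ a → ind (deq a c) * f a) ≡ f c
  delta-f c f = begin
      S (λ a → ind (deq a c) * f a)
    ≡⟨ S-cong (λ a → at-point a (deq a c)) ⟩
      S (λ a → ind (deq a c) * f c)
    ≡⟨ S-scalʳ (f c) (λ a → ind (deq a c)) ⟩
      S (λ a → ind (deq a c)) * f c
    ≡⟨ cong (_* f c) (delta c) ⟩
      f c + 0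
    ≡⟨ +-identityʳ (f c) ⟩
      f c ∎
    where
    at-point : ∀ a (d : Dec (a ≡ c)) → ind d * f a ≡ ind d * f c
    at-point a (yes refl) = refl
    at-point a (no _) = refl

  delta-f' : ∀ c (f : A → ℕ) → S (λ a → ind (deq c a) * f a) ≡ f c
  delta-f' c f = trans (S-cong (λ a → cong (_* f a) (ind-iff (deq c a) (deq a c) sym sym))) (delta-f c f)

Σᶠ : ∀ n → (Fin n → ℕ) → ℕ
Σᶠ zero f = 0
Σᶠ (suc n) f = f zero + Σᶠ n (λ i → f (suc i))

Σᶠ-cong : ∀ n {f g : Fin n → ℕ} → (∀ a → f a ≡ g a) → Σᶠ n f ≡ Σᶠ n g
Σᶠ-cong zero h = refl
Σᶠ-cong (suc n) h = cong₂ _+_ (h zero) (Σᶠ-cong n (λ i → h (suc i)))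

+-interchange : ∀ a b c d → (a + b) + (c + d) ≡ (a + c) + (b + d)
+-interchange a b c d = begin
  (a + b) + (c + d) ≡⟨ +-assoc a b (c + d) ⟩
  a + (b + (c + d)) ≡⟨ cong (a +_) (sym (+-assoc b c d)) ⟩
  a + ((b + c) + d) ≡⟨ cong (λ x → a + (x + d)) (+-comm b c) ⟩
  a + ((c + b) + d) ≡⟨ cong (a +_) (+-assoc c b d) ⟩
  a + (c + (b + d)) ≡⟨ sym (+-assoc a c (b + d)) ⟩
  (a + c) + (b + d) ∎

Σᶠ-+ : ∀ n (f g : Fin n → ℕ) → Σᶠ n (λ a → f a + g a) ≡ Σᶠ n f + Σᶠ n g
Σᶠ-+ zero f g = refl
Σᶠ-+ (suc n) f g = trans (cong ((f zero + g zero) +_) (Σᶠ-+ n (λ i → f (suc i)) (λ i → g (suc i))))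
                         (+-interchange (f zero) (g zero) _ _)

Σᶠ-0 : ∀ n → Σᶠ n (λ _ → 0) ≡ 0
Σᶠ-0 zero = refl
Σᶠ-0 (suc n) = Σᶠ-0 n

linFin : ∀ n → LinearSum (Fin n)
linFin n = record { S = Σᶠ n ; S-cong = Σᶠ-cong n ; S-+ = Σᶠ-+ n ; S-0 = Σᶠ-0 n }

Σᶠ-comm : ∀ n {B : Set} (T : LinearSum B) (h : Fin n → B → ℕ) →
  Σᶠ n (λ a → LinearSum.S T (h a)) ≡ LinearSum.S T (λ b → Σᶠ n (λ a → h a b))
Σᶠ-comm zero T h = sym (LinearSum.S-0 T)
Σᶠ-comm (suc n) T h = trans (cong (LinearSum.S T (h zero) +_) (Σᶠ-comm n T (λ i → h (suc i))))
                            (sym (LinearSum.S-+ T (h zero) (λ b → Σᶠ n (λ a → h (suc a) b))))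

Σᶠ-delta : ∀ n (c : Fin n) → Σᶠ n (λ a → ind (a FinP.≟ c)) ≡ 1
Σᶠ-delta (suc n) zero = cong suc (Σᶠ-zero' n)
  where
  Σᶠ-zero' : ∀ m → Σᶠ m (λ a → ind (suc a FinP.≟ (zero {m}))) ≡ 0
  Σᶠ-zero' m = trans (Σᶠ-cong m (λ a → ind-no (suc a FinP.≟ zero) (λ ()))) (Σᶠ-0 m)
Σᶠ-delta (suc n) (suc c) = trans (cong₂ _+_ (ind-no (zero FinP.≟ suc c) (λ ()))
  (Σᶠ-cong n (λ a → ind-iff (suc a FinP.≟ suc c) (a FinP.≟ c) FinP.suc-injective (cong suc))))
  (Σᶠ-delta n c)

sumFin : ∀ n → Summation (Fin n)
sumFin n = record { lin = linFin n ; comm = Σᶠ-comm n ; deq = FinP._≟_ ; delta = Σᶠ-delta n }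

module _ {A B : Set} (SA : Summation A) (SB : Summation B) where
  private
    module A = Summation SA
    module B = Summation SB

  linProd : LinearSum (A × B)
  linProd = record
    { S = λ f → A.S (λ a → B.S (λ b → f (a , b)))
    ; S-cong = λ h → A.S-cong (λ a → B.S-cong (λ b → h (a , b)))
    ; S-+ = λ f g → trans (A.S-cong (λ a → B.S-+ _ _)) (A.S-+ _ _)
    ; S-0 = trans (A.S-cong (λ a → B.S-0)) A.S-0 }

  deqProd : DecidableEquality (A × B)
  deqProd (a , b) (a' , b') with A.deq a a' | B.deq b b'
  ... | yes refl | yes refl = yes refl
  ... | no ne | _ = no (λ e → ne (cong proj₁ e))
  ... | yes _ | no ne = no (λ e → ne (cong proj₂ e))

  sumProd : Summation (A × B)
  sumProd = record
    { lin = linProd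
    ; comm = λ T h → trans (A.S-cong (λ a → B.comm T (λ b → h (a , b)))) (A.comm T (λ a b' → B.S (λ b → h (a , b) b')))
    ; deq = deqProd
    ; delta = λ c → trans (A.S-cong (λ a → B.S-cong (λ b → ind-pair a b c)))
                    (trans (A.S-cong (λ a → B.S-scal (ind (A.deq a (proj₁ c))) (λ b → ind (B.deq b (proj₂ c)))))
                    (trans (A.S-cong (λ a → cong (ind (A.deq a (proj₁ c)) *_) (B.delta (proj₂ c))))
                    (trans (A.S-cong (λ a → *-identityʳ _)) (A.delta (proj₁ c)))))
    }
    where
    ind-pair : ∀ a b c → ind (deqProd (a , b) c) ≡ ind (A.deq a (proj₁ c)) * ind (B.deq b (proj₂ c))
    ind-pair a b (a' , b') with A.deq a a' | B.deq b b'
    ... | yes refl | yes refl = refl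
    ... | no ne | _ = refl
    ... | yes refl | no ne = refl

ΣV : ∀ n m → (Vec (Fin n) m → ℕ) → ℕ
ΣV n zero f = f []
ΣV n (suc m) f = Σᶠ n (λ x → ΣV n m (λ w → f (x ∷ w)))

ΣV-cong : ∀ n m {f g : Vec (Fin n) m → ℕ} → (∀ a → f a ≡ g a) → ΣV n m f ≡ ΣV n m g
ΣV-cong n zero h = h []
ΣV-cong n (suc m) h = Σᶠ-cong n (λ x → ΣV-cong n m (λ w → h (x ∷ w)))

ΣV-+ : ∀ n m (f g : Vec (Fin n) m → ℕ) → ΣV n m (λ a → f a + g a) ≡ ΣV n m f + ΣV n m g
ΣV-+ n zero f g = refl
ΣV-+ n (suc m) f g = trans (Σᶠ-cong n (λ x → ΣV-+ n m _ _)) (Σᶠ-+ n _ _)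

ΣV-0 : ∀ n m → ΣV n m (λ _ → 0) ≡ 0
ΣV-0 n zero = refl
ΣV-0 n (suc m) = trans (Σᶠ-cong n (λ x → ΣV-0 n m)) (Σᶠ-0 n)

linVec : ∀ n m → LinearSum (Vec (Fin n) m)
linVec n m = record { S = ΣV n m ; S-cong = ΣV-cong n m ; S-+ = ΣV-+ n m ; S-0 = ΣV-0 n m }

ΣV-comm : ∀ n m {B : Set} (T : LinearSum B) (h : Vec (Fin n) m → B → ℕ) →
  ΣV n m (λ a → LinearSum.S T (h a)) ≡ LinearSum.S T (λ b → ΣV n m (λ a → h a b))
ΣV-comm n zero T h = LinearSum.S-cong T (λ b → refl)
ΣV-comm n (suc m) T h = trans (Σᶠ-cong n (λ x → ΣV-comm n m T (λ w → h (x ∷ w)))) (Σᶠ-comm n T (λ x b → ΣV n m (λ w → h (x ∷ w) b)))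

vdeq : ∀ {n m} → DecidableEquality (Vec (Fin n) m)
vdeq = VecP.≡-dec FinP._≟_

ΣV-delta : ∀ n m (c : Vec (Fin n) m) → ΣV n m (λ a → ind (vdeq a c)) ≡ 1
ΣV-delta n zero [] = refl
ΣV-delta n (suc m) (c ∷ cs) =
  trans (Σᶠ-cong n (λ x → ΣV-cong n m (λ w → ind-cons x w)))
  (trans (Σᶠ-cong n (λ x → LinearSumProps.S-scal (linVec n m) (ind (x FinP.≟ c)) (λ w → ind (vdeq w cs))))
  (trans (Σᶠ-cong n (λ x → trans (cong (ind (x FinP.≟ c) *_) (ΣV-delta n m cs)) (*-identityʳ _)))
    (Σᶠ-delta n c)))
  where
  ind-cons : ∀ x w → ind (vdeq (x ∷ w) (c ∷ cs)) ≡ ind (x FinP.≟ c) * ind (vdeq w cs)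
  ind-cons x w = cases (x FinP.≟ c) (vdeq w cs)
    where
    big = vdeq (x ∷ w) (c ∷ cs)
    cases : Dec (x ≡ c) → Dec (w ≡ cs) → ind big ≡ ind (x FinP.≟ c) * ind (vdeq w cs)
    cases (yes e1) (yes e2) = trans (ind-yes big (cong₂ _∷_ e1 e2)) (sym (cong₂ _*_ (ind-yes (x FinP.≟ c) e1) (ind-yes (vdeq w cs) e2)))
    cases (yes e1) (no ne) = trans (ind-no big (λ e → ne (cong Data.Vec.tail e))) (sym (trans (cong (ind (x FinP.≟ c) *_) (ind-no (vdeq w cs) ne)) (*-zeroʳ (ind (x FinP.≟ c)))))
    cases (no ne) _ = trans (ind-no big (λ e → ne (cong Data.Vec.head e))) (sym (cong (_* ind (vdeq w cs)) (ind-no (x FinP.≟ c) ne)))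

sumVec : ∀ n m → Summation (Vec (Fin n) m)
sumVec n m = record { lin = linVec n m ; comm = ΣV-comm n m ; deq = vdeq ; delta = ΣV-delta n m }

ΣL : ∀ {A : Set} → List A → (A → ℕ) → ℕ
ΣL [] F = 0
ΣL (x ∷ xs) F = F x + ΣL xs F

ΣL-++ : ∀ {A : Set} (xs ys : List A) F → ΣL (xs ++ ys) F ≡ ΣL xs F + ΣL ys F
ΣL-++ [] ys F = refl
ΣL-++ (x ∷ xs) ys F = trans (cong (F x +_) (ΣL-++ xs ys F)) (sym (+-assoc (F x) _ _))

ΣL-map : ∀ {A B : Set} (h : A → B) (xs : List A) F → ΣL (L.map h xs) F ≡ ΣL xs (λ x → F (h x))
ΣL-map h [] F = refl
ΣL-map h (x ∷ xs) F = cong (F (h x) +_) (ΣL-map h xs F)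

ΣL-concatMap : ∀ {A B : Set} (g : A → List B) (xs : List A) F → ΣL (concatMap g xs) F ≡ ΣL xs (λ x → ΣL (g x) F)
ΣL-concatMap g [] F = refl
ΣL-concatMap g (x ∷ xs) F = trans (ΣL-++ (g x) (concatMap g xs) F) (cong (ΣL (g x) F +_) (ΣL-concatMap g xs F))

ΣL-cong : ∀ {A : Set} (xs : List A) {F G : A → ℕ} → (∀ a → F a ≡ G a) → ΣL xs F ≡ ΣL xs G
ΣL-cong [] h = refl
ΣL-cong (x ∷ xs) h = cong₂ _+_ (h x) (ΣL-cong xs h)

ΣL-filter : ∀ {A : Set} {P : A → Set} (P? : Decidable P) (xs : List A) F →
  ΣL (filter P? xs) F ≡ ΣL xs (λ x → ind (P? x) * F x)
ΣL-filter P? [] F = refl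
ΣL-filter P? (x ∷ xs) F with P? x
... | yes _ = cong₂ _+_ (sym (+-identityʳ (F x))) (ΣL-filter P? xs F)
... | no _ = ΣL-filter P? xs F

length-ΣL : ∀ {A : Set} (xs : List A) → length xs ≡ ΣL xs (λ _ → 1)
length-ΣL [] = refl
length-ΣL (x ∷ xs) = cong suc (length-ΣL xs)

length-filter : ∀ {A : Set} {P : A → Set} (P? : Decidable P) (xs : List A) →
  length (filter P? xs) ≡ ΣL xs (λ x → ind (P? x))
length-filter P? xs = trans (length-ΣL (filter P? xs)) (trans (ΣL-filter P? xs (λ _ → 1)) (ΣL-cong xs (λ x → *-identityʳ _)))

ΣL-tabulate : ∀ {A : Set} n (h : Fin n → A) F → ΣL (L.tabulate h) F ≡ Σᶠ n (λ i → F (h i))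
ΣL-tabulate zero h F = refl
ΣL-tabulate (suc n) h F = cong (F (h zero) +_) (ΣL-tabulate n (λ i → h (suc i)) F)

ΣL-allFin : ∀ n F → ΣL (allFin n) F ≡ Σᶠ n F
ΣL-allFin n F = ΣL-tabulate n (λ i → i) F

ΣL-allVecs : ∀ n m F → ΣL (allVecs n m) F ≡ ΣV n m F
ΣL-allVecs n zero F = +-identityʳ _
ΣL-allVecs n (suc m) F = begin
  ΣL (concatMap (λ x → L.map (x ∷_) (allVecs n m)) (allFin n)) F
    ≡⟨ ΣL-concatMap _ (allFin n) F ⟩
  ΣL (allFin n) (λ x → ΣL (L.map (x ∷_) (allVecs n m)) F)
    ≡⟨ ΣL-allFin n _ ⟩
  Σᶠ n (λ x → ΣL (L.map (x ∷_) (allVecs n m)) F)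
    ≡⟨ Σᶠ-cong n (λ x → trans (ΣL-map (x ∷_) (allVecs n m) F) (ΣL-allVecs n m (λ w → F (x ∷ w)))) ⟩
  ΣV n (suc m) F ∎

module _ {A B : Set} (SA : Summation A) (SB : Summation B) where
  private
    module A = Summation SA
    module B = Summation SB
  sum-bijection : (P : A → Set) (Q : B → Set) (P? : Decidable P) (f : A → B) (g : B → A) (G : A → ℕ) (F : B → ℕ)
    (g∘f : ∀ a → P a → g (f a) ≡ a) (f∘g : ∀ b → Q b → f (g b) ≡ b) (f-support : ∀ a → P a → Q (f a))
    (G-outside : ∀ a → ¬ P a → G a ≡ 0) (F≡G∘g : ∀ b → Q b → F b ≡ G (g b)) (F-outside : ∀ b → ¬ Q b → F b ≡ 0)
    (Q? : Decidable Q) → B.S F ≡ A.S G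
  sum-bijection P Q P? f g G F g∘f f∘g f-support G-outside F≡G∘g F-outside Q? = begin
      B.S F
    ≡⟨ B.S-cong fiber-sum ⟩
      B.S (λ b → A.S (λ a → ind (B.deq (f a) b) * G a))
    ≡⟨ sym (A.comm B.lin (λ a b → ind (B.deq (f a) b) * G a)) ⟩
      A.S (λ a → B.S (λ b → ind (B.deq (f a) b) * G a))
    ≡⟨ A.S-cong (λ a → B.delta-f' (f a) (λ _ → G a)) ⟩
      A.S G ∎
    where
    fiber-sum : ∀ b → F b ≡ A.S (λ a → ind (B.deq (f a) b) * G a)
    fiber-sum b with Q? b
    ... | yes q = sym (trans (A.S-cong fiber-term) (trans (A.delta-f (g b) G) (sym (F≡G∘g b q))))
      where
      fiber-term : ∀ a → ind (B.deq (f a) b) * G a ≡ ind (A.deq a (g b)) * G a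
      fiber-term a with P? a
      ... | yes p = cong (_* G a) (ind-iff (B.deq (f a) b) (A.deq a (g b))
                       (λ e → trans (sym (g∘f a p)) (cong g e)) (λ e → trans (cong f e) (f∘g b q)))
      ... | no np = trans (cong (ind (B.deq (f a) b) *_) (G-outside a np)) (trans (*-zeroʳ (ind (B.deq (f a) b))) (sym (trans (cong (ind (A.deq a (g b)) *_) (G-outside a np)) (*-zeroʳ (ind (A.deq a (g b)))))))
    ... | no nq = trans (F-outside b nq) (sym (A.S-zero fiber-term))
      where
      fiber-term : ∀ a → ind (B.deq (f a) b) * G a ≡ 0
      fiber-term a with P? a
      ... | no np = trans (cong (ind (B.deq (f a) b) *_) (G-outside a np)) (*-zeroʳ (ind (B.deq (f a) b)))
      ... | yes p = cong (_* G a) (ind-no (B.deq (f a) b) (λ e → nq (subst Q e (f-support a p))))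

Inj : ∀ {n m} → Vec (Fin n) m → Set
Inj {n} {m} v = ∀ (i j : Fin m) → lookup v i ≡ lookup v j → i ≡ j

all-toList : ∀ {n m} {P : Fin n → Set} (v : Vec (Fin n) m) → All P (toList v) → ∀ i → P (lookup v i)
all-toList (x ∷ v) (px ∷ a) zero = px
all-toList (x ∷ v) (px ∷ a) (suc i) = all-toList v a i

toList-all : ∀ {n m} {P : Fin n → Set} (v : Vec (Fin n) m) → (∀ i → P (lookup v i)) → All P (toList v)
toList-all [] h = []
toList-all (x ∷ v) h = h zero ∷ toList-all v (λ i → h (suc i))

uniq⇒inj : ∀ {n m} (v : Vec (Fin n) m) → Unique (toList v) → Inj v
uniq⇒inj (x ∷ v) (a ∷ u) zero zero e = refl
uniq⇒inj (x ∷ v) (a ∷ u) zero (suc j) e = ⊥-elim (all-toList v a j e)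
uniq⇒inj (x ∷ v) (a ∷ u) (suc i) zero e = ⊥-elim (all-toList v a i (sym e))
uniq⇒inj (x ∷ v) (a ∷ u) (suc i) (suc j) e = cong suc (uniq⇒inj v u i j e)

inj⇒uniq : ∀ {n m} (v : Vec (Fin n) m) → Inj v → Unique (toList v)
inj⇒uniq [] h = []
inj⇒uniq (x ∷ v) h = toList-all v (λ i e → FinP.0≢1+n (h zero (suc i) e))
                   ∷ inj⇒uniq v (λ i j e → FinP.suc-injective (h (suc i) (suc j) e))

excS : ∀ {n} → Vec (Fin n) n → ℕ
excS {n} v = Σᶠ n (λ i → ind (toℕ i <? toℕ (lookup v i)))

exc≡ : ∀ {n} (v : Vec (Fin n) n) → exc v ≡ excS v
exc≡ {n} v = trans (length-filter (λ i → toℕ i <? toℕ (lookup v i)) (allFin n)) (ΣL-allFin n _)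

invS : ∀ {n} → Vec (Fin n) n → ℕ
invS {n} v = Σᶠ n (λ i → Σᶠ n (λ j → ind (toℕ i <? toℕ j) * ind (toℕ (lookup v j) <? toℕ (lookup v i))))

inv≡ : ∀ {n} (v : Vec (Fin n) n) → inv v ≡ invS v
inv≡ {n} v = begin
    inv v
  ≡⟨ length-filter Q? (filter R? LL) ⟩
    ΣL (filter R? LL) (λ ij → ind (Q? ij))
  ≡⟨ ΣL-filter R? LL _ ⟩
    ΣL LL (λ ij → ind (R? ij) * ind (Q? ij))
  ≡⟨ ΣL-concatMap _ (allFin n) _ ⟩
    ΣL (allFin n) (λ i → ΣL (L.map (λ j → i , j) (allFin n)) (λ ij → ind (R? ij) * ind (Q? ij)))
  ≡⟨ ΣL-allFin n _ ⟩
    Σᶠ n (λ i → ΣL (L.map (λ j → i , j) (allFin n)) (λ ij → ind (R? ij) * ind (Q? ij)))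
  ≡⟨ Σᶠ-cong n (λ i → trans (ΣL-map _ (allFin n) _) (ΣL-allFin n _)) ⟩
    invS v ∎
  where
  LL = concatMap (λ i → L.map (λ j → i , j) (allFin n)) (allFin n)
  Q? = λ (ij : Fin n × Fin n) → toℕ (lookup v (proj₂ ij)) <? toℕ (lookup v (proj₁ ij))
  R? = λ (ij : Fin n × Fin n) → toℕ (proj₁ ij) <? toℕ (proj₂ ij)

parity : ∀ {n} → Vec (Fin n) n → Bool
parity v = does (isEven? v)

IsDerPerm : ∀ {n} → Vec (Fin n) n → Set
IsDerPerm v = IsPerm v × IsDerangement v

isDerPerm? : ∀ {n} → Decidable (IsDerPerm {n})
isDerPerm? v = isPerm? v ×-dec isDerangement? v

-- derSum n Φ = Σ_{π ∈ 𝔖𝔇_n} Φ(exc π, parity π): every statistic we count is of this form.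
derSum : ∀ n → (ℕ → Bool → ℕ) → ℕ
derSum n Φ = ΣV n n (λ v → ind (isPerm? v) * (ind (isDerangement? v) * Φ (exc v) (parity v)))

ΣL-SD : ∀ n (W : Vec (Fin n) n → ℕ) → ΣL (SD n) W ≡ ΣV n n (λ v → ind (isPerm? v) * (ind (isDerangement? v) * W v))
ΣL-SD n W = trans (ΣL-filter isDerangement? (𝔖 n) W) (trans (ΣL-filter isPerm? (allVecs n n) _) (ΣL-allVecs n n _))

ADerExc≡derSum : ∀ n k → ADerExc n k ≡ derSum n (λ e s → ind (e ≟ k))
ADerExc≡derSum n k = trans (length-filter (λ v → exc v ≟ k) (SD n)) (ΣL-SD n _)

matches : Bool → Bool → Bool
matches true s = s
matches false s = not s

matches-not : ∀ p s → matches p (not s) ≡ matches (not p) s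
matches-not true s = refl
matches-not false true = refl
matches-not false false = refl

derCount : ℕ → Bool → ℕ → ℕ
derCount n p k = derSum n (λ e s → bit (matches p s) * ind (e ≟ k))

ADerExc⁺≡derCount : ∀ n k → ADerExc⁺ n k ≡ derCount n true k
ADerExc⁺≡derCount n k = trans (length-filter (λ v → exc v ≟ k) (SD⁺ n))
  (trans (ΣL-filter isEven? (SD n) _) (trans (ΣL-SD n _)
  (ΣV-cong n n (λ v → cong (λ z → ind (isPerm? v) * (ind (isDerangement? v) * (z * ind (exc v ≟ k)))) (ind-bit (isEven? v))))))

ADerExc⁻≡derCount : ∀ n k → ADerExc⁻ n k ≡ derCount n false k
ADerExc⁻≡derCount n k = trans (length-filter (λ v → exc v ≟ k) (SD⁻ n))
  (trans (ΣL-filter (λ v → ¬? (isEven? v)) (SD n) _) (trans (ΣL-SD n _)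
  (ΣV-cong n n (λ v → cong (λ z → ind (isPerm? v) * (ind (isDerangement? v) * (z * ind (exc v ≟ k)))) (ind-¬ (isEven? v))))))

derSum-cong : ∀ n {Φ Ψ : ℕ → Bool → ℕ} → (∀ e s → Φ e s ≡ Ψ e s) → derSum n Φ ≡ derSum n Ψ
derSum-cong n h = ΣV-cong n n (λ v → cong (λ z → ind (isPerm? v) * (ind (isDerangement? v) * z)) (h (exc v) (parity v)))

derSum-+ : ∀ n (Φ Ψ : ℕ → Bool → ℕ) → derSum n (λ e s → Φ e s + Ψ e s) ≡ derSum n Φ + derSum n Ψ
derSum-+ n Φ Ψ = trans (ΣV-cong n n (λ v → distrib (ind (isPerm? v)) (ind (isDerangement? v)) (Φ (exc v) (parity v)) (Ψ (exc v) (parity v))))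
                    (ΣV-+ n n _ _)
  where
  distrib : ∀ a b x y → a * (b * (x + y)) ≡ a * (b * x) + a * (b * y)
  distrib = solve-∀

derSum-scal : ∀ n c (Φ : ℕ → Bool → ℕ) → derSum n (λ e s → c * Φ e s) ≡ c * derSum n Φ
derSum-scal n c Φ = trans (ΣV-cong n n (λ v → comm (ind (isPerm? v)) (ind (isDerangement? v)) c (Φ (exc v) (parity v))))
                       (LinearSumProps.S-scal (linVec n n) c _)
  where
  comm : ∀ a b c x → a * (b * (c * x)) ≡ c * (a * (b * x))
  comm = solve-∀

derSum-0 : ∀ n → derSum n (λ _ _ → 0) ≡ 0
derSum-0 n = trans (ΣV-cong n n (λ v → trans (cong (ind (isPerm? v) *_) (*-zeroʳ (ind (isDerangement? v)))) (*-zeroʳ (ind (isPerm? v))))) (ΣV-0 n n)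

ADerExc-split : ∀ n k → ADerExc n k ≡ derCount n true k + derCount n false k
ADerExc-split n k = trans (ADerExc≡derSum n k) (trans (derSum-cong n by-parity)
  (derSum-+ n (λ e s → bit (matches true s) * ind (e ≟ k)) (λ e s → bit (matches false s) * ind (e ≟ k))))
  where
  by-parity : ∀ e s → ind (e ≟ k) ≡ bit (matches true s) * ind (e ≟ k) + bit (matches false s) * ind (e ≟ k)
  by-parity e true = sym (trans (+-identityʳ _) (+-identityʳ _))
  by-parity e false = sym (+-identityʳ _)

-- An injective word of length n over Fin n takes every value exactly once, so
-- a sum over Fin n may be reindexed along it.
Σᶠ-const1 : ∀ n → Σᶠ n (λ _ → 1) ≡ n
Σᶠ-const1 zero = refl
Σᶠ-const1 (suc n) = cong suc (Σᶠ-const1 n)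

Σᶠ≤ : ∀ n (f : Fin n → ℕ) → (∀ c → f c ≤ 1) → Σᶠ n f ≤ n
Σᶠ≤ zero f h = z≤n
Σᶠ≤ (suc n) f h = +-mono-≤ (h zero) (Σᶠ≤ n (λ i → f (suc i)) (λ i → h (suc i)))

all-one : ∀ n (f : Fin n → ℕ) → (∀ c → f c ≤ 1) → Σᶠ n f ≡ n → ∀ c → f c ≡ 1
all-one (suc n) f h e c with f zero | h zero | inspect f zero
... | zero | _ | _ = ⊥-elim (<-irrefl refl (subst (_≤ n) e (Σᶠ≤ n (λ i → f (suc i)) (λ i → h (suc i)))))
... | suc zero | _ | [ eq ] = each c
  where
  each : ∀ c → f c ≡ 1
  each zero = eq
  each (suc c) = all-one n (λ i → f (suc i)) (λ i → h (suc i)) (suc-injective e) c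
... | suc (suc _) | s≤s () | _

module _ {n} (v : Vec (Fin n) n) (inj : Inj v) where
  preimage-count≤1 : ∀ c → Σᶠ n (λ q → ind (lookup v q FinP.≟ c)) ≤ 1
  preimage-count≤1 c with FinP.any? (λ q → lookup v q FinP.≟ c)
  ... | yes (q0 , e0) = ≤-reflexive (trans (Σᶠ-cong n (λ q → ind-iff (lookup v q FinP.≟ c) (q FinP.≟ q0)
                              (λ e → inj q q0 (trans e (sym e0))) (λ e → trans (cong (lookup v) e) e0)))
                          (Σᶠ-delta n q0))
  ... | no nq = ≤-trans (≤-reflexive (trans (Σᶠ-cong n (λ q → ind-no (lookup v q FinP.≟ c) (λ e → nq (q , e)))) (Σᶠ-0 n))) z≤n

  preimage-count : ∀ c → Σᶠ n (λ q → ind (lookup v q FinP.≟ c)) ≡ 1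
  preimage-count = all-one n _ preimage-count≤1 tot
    where
    tot : Σᶠ n (λ c → Σᶠ n (λ q → ind (lookup v q FinP.≟ c))) ≡ n
    tot = trans (sym (Σᶠ-comm n (linFin n) (λ q c → ind (lookup v q FinP.≟ c))))
          (trans (Σᶠ-cong n (λ q → trans (Σᶠ-cong n (λ c → sym (*-identityʳ (ind (lookup v q FinP.≟ c)))))
                     (Summation.delta-f' (sumFin n) (lookup v q) (λ _ → 1))))
                 (Σᶠ-const1 n))

  Σᶠ-permute : ∀ (F : Fin n → ℕ) → Σᶠ n (λ q → F (lookup v q)) ≡ Σᶠ n F
  Σᶠ-permute F = begin
      Σᶠ n (λ q → F (lookup v q))
    ≡⟨ Σᶠ-cong n (λ q → sym (Summation.delta-f' (sumFin n) (lookup v q) F)) ⟩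
      Σᶠ n (λ q → Σᶠ n (λ c → ind (lookup v q FinP.≟ c) * F c))
    ≡⟨ Σᶠ-comm n (linFin n) (λ q c → ind (lookup v q FinP.≟ c) * F c) ⟩
      Σᶠ n (λ c → Σᶠ n (λ q → ind (lookup v q FinP.≟ c) * F c))
    ≡⟨ Σᶠ-cong n (λ c → trans (LinearSumProps.S-scalʳ (linFin n) (F c) (λ q → ind (lookup v q FinP.≟ c)))
          (trans (cong (_* F c) (preimage-count c)) (+-identityʳ (F c)))) ⟩
      Σᶠ n F ∎

vec-ext : ∀ {A : Set} {m} (u v : Vec A m) → (∀ i → lookup u i ≡ lookup v i) → u ≡ v
vec-ext [] [] h = refl
vec-ext (x ∷ u) (y ∷ v) h = cong₂ _∷_ (h zero) (vec-ext u v (λ i → h (suc i)))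

FixedOnlyAt : ∀ {M} → Fin M → Vec (Fin M) M → Set
FixedOnlyAt {M} b σ = ∀ q → lookup σ q ≡ q → lookup σ q ≡ b

fixedOnlyAt? : ∀ {M} (b : Fin M) (σ : Vec (Fin M) M) → Dec (FixedOnlyAt b σ)
fixedOnlyAt? b σ with FinP.all? (λ q → ¬? ((lookup σ q FinP.≟ q) ×-dec ¬? (lookup σ q FinP.≟ b)))
... | yes h = yes (λ q e → decidable-stable (lookup σ q FinP.≟ b) (λ ne → h q (e , ne)))
... | no nh = no (λ F → nh (λ q pr → proj₂ pr (F q (proj₁ pr))))

excAvoiding : ∀ {M} → Fin M → Vec (Fin M) M → ℕ
excAvoiding {M} b σ = Σᶠ M (λ q → ind (toℕ q <? toℕ (lookup σ q)) * ind (¬? (lookup σ q FinP.≟ b)))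

-- A derangement π of [M+1] starts
-- with some b+1; detach π = (b, σ) where σ ∈ 𝔖_M is read off from the remaining
-- letters with the value 0 renamed to b (`lower b`).  Conversely attach (b, σ)
-- prepends b+1 and renames the value b to 0 (`raise b`).  The two are inverse
-- between derangements of [M+1] and pairs (b, σ) with σ fixing at most b.
module Attach (N : ℕ) where
  M = suc N

  raise : Fin M → Fin M → Fin (suc M)
  raise b y with y FinP.≟ b
  ... | yes _ = zero
  ... | no _ = suc y

  lower : Fin M → Fin (suc M) → Fin M
  lower b zero = b
  lower b (suc y) = y

  -- The first letter of a derangement is b+1; headPred recovers b.
  headPred : Fin (suc M) → Fin M
  headPred zero = zero
  headPred (suc y) = y

  attach : Fin M × Vec (Fin M) M → Vec (Fin (suc M)) (suc M)
  attach (b , σ) = suc b ∷ V.map (raise b) σ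

  detach : Vec (Fin (suc M)) (suc M) → Fin M × Vec (Fin M) M
  detach (x ∷ τ) = headPred x , V.map (lower (headPred x)) τ

  lower-raise : ∀ b y → lower b (raise b y) ≡ y
  lower-raise b y with y FinP.≟ b
  ... | yes e = sym e
  ... | no _ = refl

  raise-lower : ∀ b x → x ≢ suc b → raise b (lower b x) ≡ x
  raise-lower b zero ne with b FinP.≟ b
  ... | yes _ = refl
  ... | no nb = ⊥-elim (nb refl)
  raise-lower b (suc y) ne with y FinP.≟ b
  ... | yes e = ⊥-elim (ne (cong suc e))
  ... | no _ = refl

  raise-injective : ∀ b y z → raise b y ≡ raise b z → y ≡ z
  raise-injective b y z e = trans (sym (lower-raise b y)) (trans (cong (lower b) e) (lower-raise b z))

  raise≢suc : ∀ b y → raise b y ≢ suc b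
  raise≢suc b y e with y FinP.≟ b
  raise≢suc b y () | yes _
  raise≢suc b y e | no ne = ne (FinP.suc-injective e)

  lookup-attach : ∀ b σ q → lookup (attach (b , σ)) (suc q) ≡ raise b (lookup σ q)
  lookup-attach b σ q = VecP.lookup-map q (raise b) σ

  detach-attach : ∀ b σ → detach (attach (b , σ)) ≡ (b , σ)
  detach-attach b σ = cong (b ,_) (trans (sym (VecP.map-∘ (lower b) (raise b) σ)) (trans (VecP.map-cong (lower-raise b) σ) (VecP.map-id σ)))

  Contracted : Fin M × Vec (Fin M) M → Set
  Contracted (b , σ) = IsPerm σ × FixedOnlyAt b σ

  contracted? : Decidable Contracted
  contracted? (b , σ) = isPerm? σ ×-dec fixedOnlyAt? b σ

  attach-detach : ∀ π → IsDerPerm π → attach (detach π) ≡ π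
  attach-detach (zero ∷ τ) (_ , der) = ⊥-elim (der zero refl)
  attach-detach (suc b ∷ τ) (perm , der) = cong (suc b ∷_) (trans (sym (VecP.map-∘ (raise b) (lower b) τ))
       (vec-ext _ _ (λ i → trans (VecP.lookup-map i (λ x → raise b (lower b x)) τ)
          (raise-lower b (lookup τ i) (λ e → FinP.0≢1+n (uniq⇒inj (suc b ∷ τ) perm zero (suc i) (sym e)))))))

  attach-derangement : ∀ b σ → Contracted (b , σ) → IsDerPerm (attach (b , σ))
  attach-derangement b σ (perm , fix) = inj⇒uniq _ inj , der
    where
    inj : Inj (attach (b , σ))
    inj zero zero e = refl
    inj zero (suc j) e = ⊥-elim (raise≢suc b (lookup σ j) (sym (trans e (lookup-attach b σ j))))
    inj (suc i) zero e = ⊥-elim (raise≢suc b (lookup σ i) (trans (sym (lookup-attach b σ i)) e))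
    inj (suc i) (suc j) e = cong suc (uniq⇒inj σ perm i j
       (raise-injective b _ _ (trans (sym (lookup-attach b σ i)) (trans e (lookup-attach b σ j)))))
    der : IsDerangement (attach (b , σ))
    der zero ()
    der (suc q) e = value-cases (lookup σ q FinP.≟ b) (trans (sym (lookup-attach b σ q)) e)
      where
      value-cases : Dec (lookup σ q ≡ b) → raise b (lookup σ q) ≡ suc q → ⊥
      value-cases d e2 with lookup σ q FinP.≟ b
      value-cases d () | yes _
      ... | no ne = ne (fix q (FinP.suc-injective e2))

  detach-contracted : ∀ π → IsDerPerm π → Contracted (detach π)
  detach-contracted (zero ∷ τ) (_ , der) = ⊥-elim (der zero refl)
  detach-contracted (suc b ∷ τ) (perm , der) = inj⇒uniq _ inj , fix
    where
    pinj = uniq⇒inj (suc b ∷ τ) perm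
    notb : ∀ i → lookup τ i ≢ suc b
    notb i e = FinP.0≢1+n (pinj zero (suc i) (sym e))
    hinj : ∀ x y → x ≢ suc b → y ≢ suc b → lower b x ≡ lower b y → x ≡ y
    hinj x y nx ny e = trans (sym (raise-lower b x nx)) (trans (cong (raise b) e) (raise-lower b y ny))
    inj : Inj (V.map (lower b) τ)
    inj i j e = FinP.suc-injective (pinj (suc i) (suc j)
      (hinj _ _ (notb i) (notb j) (trans (sym (VecP.lookup-map i (lower b) τ)) (trans e (VecP.lookup-map j (lower b) τ)))))
    fix : FixedOnlyAt b (V.map (lower b) τ)
    fix q e = preimage (lookup τ q) refl (trans (sym (VecP.lookup-map q (lower b) τ)) e)
      where
      preimage : ∀ x → lookup τ q ≡ x → lower b x ≡ q → lookup (V.map (lower b) τ) q ≡ b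
      preimage zero ex e2 = trans (VecP.lookup-map q (lower b) τ) (cong (lower b) ex)
      preimage (suc y) ex e2 = ⊥-elim (der (suc q) (trans ex (cong suc e2)))

  -- attach adds the excedance at position 0 and loses exactly the one (if any)
  -- whose value b becomes 0.
  exc-raise : ∀ b (q : Fin M) y → ind (suc (toℕ q) <? toℕ (raise b y)) ≡ ind (toℕ q <? toℕ y) * ind (¬? (y FinP.≟ b))
  exc-raise b q y with y FinP.≟ b
  ... | yes _ = sym (*-zeroʳ (ind (toℕ q <? toℕ y)))
  ... | no _ = trans (ind-iff (suc (toℕ q) <? suc (toℕ y)) (toℕ q <? toℕ y) s≤s⁻¹ s≤s) (sym (*-identityʳ _))

  exc-attach : ∀ b σ → excS (attach (b , σ)) ≡ suc (excAvoiding b σ)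
  exc-attach b σ = cong suc (Σᶠ-cong M (λ q → trans (cong (λ z → ind (suc (toℕ q) <? toℕ z)) (lookup-attach b σ q))
                                             (exc-raise b q (lookup σ q))))

  -- Position 0 (value b+1) is inverted with the
  -- 1 + #{r : σ r < b} positions carrying a smaller value; among the other
  -- positions, renaming b to 0 only affects pairs involving the value b.  With
  -- A, B, C counting pairs q < r with (σ q = b, σ r < b), (σ r = b, σ q > b),
  -- (σ r = b, σ q < b), one finds inv π = 1 + inv σ + 2C: the parity flips.
  module AttachInversions (b : Fin M) (σ : Vec (Fin M) M) (σinj : Inj σ) where
    y : Fin M → Fin M
    y q = lookup σ q
    L : Fin M → Fin M → ℕ
    L q r = ind (toℕ q <? toℕ r)
    eb ltb gtb neb : Fin M → ℕ
    eb z = ind (z FinP.≟ b)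
    ltb z = ind (toℕ z <? toℕ b)
    gtb z = ind (toℕ b <? toℕ z)
    neb z = ind (¬? (z FinP.≟ b))

    b≮b : ind (toℕ b <? toℕ b) ≡ 0
    b≮b = ind-no (toℕ b <? toℕ b) (<-irrefl refl)

    first-row-term : ∀ z → ind (toℕ (raise b z) <? suc (toℕ b)) ≡ eb z + ltb z
    first-row-term z with z FinP.≟ b
    ... | yes refl = cong suc (sym b≮b)
    ... | no _ = ind-iff (suc (toℕ z) <? suc (toℕ b)) (toℕ z <? toℕ b) s≤s⁻¹ s≤s

    inner-term : ∀ yq yr → ind (toℕ (raise b yr) <? toℕ (raise b yq)) + (eb yq * ltb yr + eb yr * gtb yq)
                        ≡ ind (toℕ yr <? toℕ yq) + eb yr * neb yq
    inner-term yq yr with yq FinP.≟ b | yr FinP.≟ b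
    ... | yes refl | yes refl rewrite b≮b = refl
    ... | yes refl | no _ = +-identityʳ (ltb yr + 0)
    ... | no _ | yes refl = trans (cong suc (+-identityʳ (gtb yq))) (+-comm 1 (gtb yq))
    ... | no _ | no _ = cong (_+ 0) (ind-iff (suc (toℕ yr) <? suc (toℕ yq)) (toℕ yr <? toℕ yq) s≤s⁻¹ s≤s)

    ≢b-split : ∀ z → neb z ≡ ltb z + gtb z
    ≢b-split z with z FinP.≟ b
    ... | yes refl rewrite b≮b = refl
    ... | no ne with <-cmp (toℕ z) (toℕ b)
    ...   | tri< a _ c = sym (cong₂ _+_ (ind-yes (toℕ z <? toℕ b) a) (ind-no (toℕ b <? toℕ z) c))
    ...   | tri≈ _ e _ = ⊥-elim (ne (FinP.toℕ-injective e))
    ...   | tri> a _ c = sym (cong₂ _+_ (ind-no (toℕ z <? toℕ b) a) (ind-yes (toℕ b <? toℕ z) c))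

    ordered-pair : ∀ q r → (L q r + L r q) * (eb (y q) * ltb (y r)) ≡ eb (y q) * ltb (y r)
    ordered-pair q r with <-cmp (toℕ q) (toℕ r)
    ... | tri< a _ c rewrite ind-yes (toℕ q <? toℕ r) a | ind-no (toℕ r <? toℕ q) c = +-identityʳ _
    ... | tri> a _ c rewrite ind-no (toℕ q <? toℕ r) a | ind-yes (toℕ r <? toℕ q) c = +-identityʳ _
    ... | tri≈ a e c rewrite ind-no (toℕ q <? toℕ r) a | ind-no (toℕ r <? toℕ q) c
                           | FinP.toℕ-injective e = diagonal (y r FinP.≟ b)
      where
      diagonal : Dec (y r ≡ b) → 0 ≡ eb (y r) * ltb (y r)
      diagonal (yes e2) rewrite e2 | b≮b = sym (*-zeroʳ (eb b))
      diagonal (no ne) rewrite ind-no (y r FinP.≟ b) ne = refl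

    ΣΣ : (Fin M → Fin M → ℕ) → ℕ
    ΣΣ f = Σᶠ M (λ q → Σᶠ M (λ r → f q r))

    ΣΣ-cong : ∀ {f g} → (∀ q r → f q r ≡ g q r) → ΣΣ f ≡ ΣΣ g
    ΣΣ-cong eq = Σᶠ-cong M (λ q → Σᶠ-cong M (λ r → eq q r))

    ΣΣ-+ : ∀ f g → ΣΣ (λ q r → f q r + g q r) ≡ ΣΣ f + ΣΣ g
    ΣΣ-+ f g = trans (Σᶠ-cong M (λ q → Σᶠ-+ M (f q) (g q))) (Σᶠ-+ M (λ q → Σᶠ M (f q)) (λ q → Σᶠ M (g q)))

    ΣΣ-swap : ∀ f → ΣΣ f ≡ ΣΣ (λ r q → f q r)
    ΣΣ-swap f = Σᶠ-comm M (linFin M) f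

    A B C Inner : ℕ
    A = ΣΣ (λ q r → L q r * (eb (y q) * ltb (y r)))
    B = ΣΣ (λ q r → L q r * (eb (y r) * gtb (y q)))
    C = ΣΣ (λ q r → L q r * (eb (y r) * ltb (y q)))
    Inner = ΣΣ (λ q r → L q r * ind (toℕ (raise b (y r)) <? toℕ (raise b (y q))))

    inner-pair : ∀ q r → L q r * ind (toℕ (raise b (y r)) <? toℕ (raise b (y q))) + (L q r * (eb (y q) * ltb (y r)) + L q r * (eb (y r) * gtb (y q)))
               ≡ L q r * ind (toℕ (y r) <? toℕ (y q)) + (L q r * (eb (y r) * ltb (y q)) + L q r * (eb (y r) * gtb (y q)))
    inner-pair q r = begin
        L q r * raised + (L q r * X + L q r * Y)
      ≡⟨ cong (L q r * raised +_) (sym (*-distribˡ-+ (L q r) X Y)) ⟩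
        L q r * raised + L q r * (X + Y)
      ≡⟨ sym (*-distribˡ-+ (L q r) raised (X + Y)) ⟩
        L q r * (raised + (X + Y))
      ≡⟨ cong (L q r *_) (inner-term (y q) (y r)) ⟩
        L q r * (ss + eb (y r) * neb (y q))
      ≡⟨ cong (λ z → L q r * (ss + eb (y r) * z)) (≢b-split (y q)) ⟩
        L q r * (ss + eb (y r) * (ltb (y q) + gtb (y q)))
      ≡⟨ cong (λ z → L q r * (ss + z)) (*-distribˡ-+ (eb (y r)) (ltb (y q)) (gtb (y q))) ⟩
        L q r * (ss + (eb (y r) * ltb (y q) + eb (y r) * gtb (y q)))
      ≡⟨ *-distribˡ-+ (L q r) ss _ ⟩
        L q r * ss + L q r * (eb (y r) * ltb (y q) + eb (y r) * gtb (y q))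
      ≡⟨ cong (L q r * ss +_) (*-distribˡ-+ (L q r) _ _) ⟩
        L q r * ss + (L q r * (eb (y r) * ltb (y q)) + L q r * (eb (y r) * gtb (y q))) ∎
      where
      raised = ind (toℕ (raise b (y r)) <? toℕ (raise b (y q)))
      ss = ind (toℕ (y r) <? toℕ (y q))
      X = eb (y q) * ltb (y r)
      Y = eb (y r) * gtb (y q)

    inner+A : Inner + A ≡ invS σ + C
    inner+A = +-cancelʳ-≡ B (Inner + A) (invS σ + C) (begin
        (Inner + A) + B
      ≡⟨ +-assoc Inner A B ⟩
        Inner + (A + B)
      ≡⟨ cong (Inner +_) (sym (ΣΣ-+ (λ q r → L q r * (eb (y q) * ltb (y r))) (λ q r → L q r * (eb (y r) * gtb (y q))))) ⟩
        Inner + ΣΣ (λ q r → L q r * (eb (y q) * ltb (y r)) + L q r * (eb (y r) * gtb (y q)))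
      ≡⟨ sym (ΣΣ-+ (λ q r → L q r * ind (toℕ (raise b (y r)) <? toℕ (raise b (y q)))) (λ q r → L q r * (eb (y q) * ltb (y r)) + L q r * (eb (y r) * gtb (y q)))) ⟩
        ΣΣ (λ q r → L q r * ind (toℕ (raise b (y r)) <? toℕ (raise b (y q))) + (L q r * (eb (y q) * ltb (y r)) + L q r * (eb (y r) * gtb (y q))))
      ≡⟨ ΣΣ-cong inner-pair ⟩
        ΣΣ (λ q r → L q r * ind (toℕ (y r) <? toℕ (y q)) + (L q r * (eb (y r) * ltb (y q)) + L q r * (eb (y r) * gtb (y q))))
      ≡⟨ ΣΣ-+ (λ q r → L q r * ind (toℕ (y r) <? toℕ (y q))) (λ q r → L q r * (eb (y r) * ltb (y q)) + L q r * (eb (y r) * gtb (y q))) ⟩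
        invS σ + ΣΣ (λ q r → L q r * (eb (y r) * ltb (y q)) + L q r * (eb (y r) * gtb (y q)))
      ≡⟨ cong (invS σ +_) (ΣΣ-+ (λ q r → L q r * (eb (y r) * ltb (y q))) (λ q r → L q r * (eb (y r) * gtb (y q)))) ⟩
        invS σ + (C + B)
      ≡⟨ sym (+-assoc (invS σ) C B) ⟩
        (invS σ + C) + B ∎)

    Σ[value≡b] : Σᶠ M (λ r → eb (y r)) ≡ 1
    Σ[value≡b] = preimage-count σ σinj b

    Σ[value<b] : Σᶠ M (λ r → ltb (y r)) ≡ A + C
    Σ[value<b] = sym (begin
        A + C
      ≡⟨ cong (A +_) (ΣΣ-swap (λ q r → L q r * (eb (y r) * ltb (y q)))) ⟩
        A + ΣΣ (λ q r → L r q * (eb (y q) * ltb (y r)))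
      ≡⟨ sym (ΣΣ-+ (λ q r → L q r * (eb (y q) * ltb (y r))) (λ q r → L r q * (eb (y q) * ltb (y r)))) ⟩
        ΣΣ (λ q r → L q r * (eb (y q) * ltb (y r)) + L r q * (eb (y q) * ltb (y r)))
      ≡⟨ ΣΣ-cong (λ q r → trans (sym (*-distribʳ-+ (eb (y q) * ltb (y r)) (L q r) (L r q))) (ordered-pair q r)) ⟩
        ΣΣ (λ q r → eb (y q) * ltb (y r))
      ≡⟨ Σᶠ-cong M (λ q → LinearSumProps.S-scal (linFin M) (eb (y q)) (λ r → ltb (y r))) ⟩
        Σᶠ M (λ q → eb (y q) * Σᶠ M (λ r → ltb (y r)))
      ≡⟨ LinearSumProps.S-scalʳ (linFin M) (Σᶠ M (λ r → ltb (y r))) (λ q → eb (y q)) ⟩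
        Σᶠ M (λ q → eb (y q)) * Σᶠ M (λ r → ltb (y r))
      ≡⟨ cong (_* Σᶠ M (λ r → ltb (y r))) Σ[value≡b] ⟩
        Σᶠ M (λ r → ltb (y r)) + 0
      ≡⟨ +-identityʳ _ ⟩
        Σᶠ M (λ r → ltb (y r)) ∎)

    π = attach (b , σ)

    invS-attach-rows : invS π ≡ Σᶠ M (λ r → ind (toℕ (raise b (y r)) <? suc (toℕ b))) + Inner
    invS-attach-rows = cong₂ _+_ (Σᶠ-cong M (λ r → trans (+-identityʳ _) (cong (λ z → ind (toℕ z <? suc (toℕ b))) (lookup-attach b σ r))))
                      (Σᶠ-cong M (λ q → Σᶠ-cong M (λ r → cong₂ _*_
                         (ind-iff (suc (toℕ q) <? suc (toℕ r)) (toℕ q <? toℕ r) s≤s⁻¹ s≤s)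
                         (cong₂ (λ u w → ind (toℕ u <? toℕ w)) (lookup-attach b σ r) (lookup-attach b σ q)))))

    invS-attach : invS π ≡ suc (invS σ + 2 * C)
    invS-attach = begin
        invS π
      ≡⟨ invS-attach-rows ⟩
        Σᶠ M (λ r → ind (toℕ (raise b (y r)) <? suc (toℕ b))) + Inner
      ≡⟨ cong (_+ Inner) (trans (Σᶠ-cong M (λ r → first-row-term (y r))) (Σᶠ-+ M (λ r → eb (y r)) (λ r → ltb (y r)))) ⟩
        (Σᶠ M (λ r → eb (y r)) + Σᶠ M (λ r → ltb (y r))) + Inner
      ≡⟨ cong₂ (λ u w → (u + w) + Inner) Σ[value≡b] Σ[value<b] ⟩
        suc ((A + C) + Inner)
      ≡⟨ cong suc (trans (cong (_+ Inner) (+-comm A C)) (+-assoc C A Inner)) ⟩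
        suc (C + (A + Inner))
      ≡⟨ cong (λ z → suc (C + z)) (trans (+-comm A Inner) inner+A) ⟩
        suc (C + (invS σ + C))
      ≡⟨ cong suc (trans (sym (+-assoc C (invS σ) C)) (trans (cong (_+ C) (+-comm C (invS σ))) (+-assoc (invS σ) C C))) ⟩
        suc (invS σ + (C + C))
      ≡⟨ cong (λ z → suc (invS σ + (C + z))) (sym (+-identityʳ C)) ⟩
        suc (invS σ + 2 * C) ∎

evenᵇ : ℕ → Bool
evenᵇ x = does ((x % 2) ≟ 0)

evenᵇ-suc : ∀ y → evenᵇ (suc y) ≡ not (evenᵇ y)
evenᵇ-suc zero = refl
evenᵇ-suc (suc zero) = refl
evenᵇ-suc (suc (suc y)) = trans (evenᵇ-2+ (suc y)) (trans (evenᵇ-suc y) (cong not (sym (evenᵇ-2+ y))))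
  where
  evenᵇ-2+ : ∀ z → evenᵇ (suc (suc z)) ≡ evenᵇ z
  evenᵇ-2+ z = cong (λ w → does (w ≟ 0)) (trans (cong (_% 2) (+-comm 2 z)) ([m+kn]%n≡m%n z 1 2))

evenᵇ-+2* : ∀ x c → evenᵇ (x + 2 * c) ≡ evenᵇ x
evenᵇ-+2* x c = cong (λ w → does (w ≟ 0)) (trans (cong (λ z → (x + z) % 2) (*-comm 2 c)) ([m+kn]%n≡m%n x c 2))

module AttachCount (N : ℕ) (Φ : ℕ → Bool → ℕ) where
  open Attach N

  parity-attach : ∀ b σ → Contracted (b , σ) → parity (attach (b , σ)) ≡ not (parity σ)
  parity-attach b σ (perm , _) = begin
      evenᵇ (inv (attach (b , σ)))
    ≡⟨ cong evenᵇ (trans (inv≡ (attach (b , σ))) (AttachInversions.invS-attach b σ (uniq⇒inj σ perm))) ⟩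
      evenᵇ (suc (invS σ + 2 * AttachInversions.C b σ (uniq⇒inj σ perm)))
    ≡⟨ evenᵇ-suc (invS σ + 2 * AttachInversions.C b σ (uniq⇒inj σ perm)) ⟩
      not (evenᵇ (invS σ + 2 * AttachInversions.C b σ (uniq⇒inj σ perm)))
    ≡⟨ cong not (evenᵇ-+2* (invS σ) (AttachInversions.C b σ (uniq⇒inj σ perm))) ⟩
      not (evenᵇ (invS σ))
    ≡⟨ cong (λ z → not (evenᵇ z)) (sym (inv≡ σ)) ⟩
      not (parity σ) ∎

  derWeight : Vec (Fin (suc M)) (suc M) → ℕ
  derWeight π = ind (isPerm? π) * (ind (isDerangement? π) * Φ (exc π) (parity π))

  pairWeight : Fin M × Vec (Fin M) M → ℕ
  pairWeight (b , σ) = ind (isPerm? σ) * (ind (fixedOnlyAt? b σ) * Φ (suc (excAvoiding b σ)) (not (parity σ)))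

  derWeight-outside : ∀ π → ¬ IsDerPerm π → derWeight π ≡ 0
  derWeight-outside π np with isPerm? π | isDerangement? π
  ... | yes p | yes d = ⊥-elim (np (p , d))
  ... | yes p | no _ = refl
  ... | no _ | _ = refl

  pairWeight-outside : ∀ bσ → ¬ Contracted bσ → pairWeight bσ ≡ 0
  pairWeight-outside (b , σ) nq with isPerm? σ | fixedOnlyAt? b σ
  ... | yes p | yes d = ⊥-elim (nq (p , d))
  ... | yes p | no _ = refl
  ... | no _ | _ = refl

  weights-agree : ∀ bσ → Contracted bσ → pairWeight bσ ≡ derWeight (attach bσ)
  weights-agree (b , σ) q@(perm , fix) = begin
      ind (isPerm? σ) * (ind (fixedOnlyAt? b σ) * Φ (suc (excAvoiding b σ)) (not (parity σ)))
    ≡⟨ cong₂ (λ u w → u * (w * Φ (suc (excAvoiding b σ)) (not (parity σ)))) (ind-yes (isPerm? σ) perm) (ind-yes (fixedOnlyAt? b σ) fix) ⟩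
      1 * (1 * Φ (suc (excAvoiding b σ)) (not (parity σ)))
    ≡⟨ cong₂ (λ u w → 1 * (1 * Φ u w)) (sym (trans (exc≡ π) (exc-attach b σ))) (sym (parity-attach b σ q)) ⟩
      1 * (1 * Φ (exc π) (parity π))
    ≡⟨ cong₂ (λ u w → u * (w * Φ (exc π) (parity π))) (sym (ind-yes (isPerm? π) (proj₁ (attach-derangement b σ q)))) (sym (ind-yes (isDerangement? π) (proj₂ (attach-derangement b σ q)))) ⟩
      derWeight π ∎
    where π = attach (b , σ)

  derSum-attach : derSum (suc M) Φ ≡ Σᶠ M (λ b → ΣV M M (λ σ → pairWeight (b , σ)))
  derSum-attach = sym
    (sum-bijection (sumVec (suc M) (suc M)) (sumProd (sumFin M) (sumVec M M)) IsDerPerm Contracted isDerPerm?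
       detach attach derWeight pairWeight
       attach-detach (λ { (b , σ) _ → detach-attach b σ }) detach-contracted
       derWeight-outside weights-agree pairWeight-outside contracted?)

-- punchIn b : Fin n → Fin (n+1) skips b, hence preserves order and its
-- position relative to b.
pIn-lt : ∀ {n} (b : Fin (suc n)) (x : Fin n) → toℕ x < toℕ b → toℕ (punchIn b x) ≡ toℕ x
pIn-lt (suc b) zero lt = refl
pIn-lt (suc b) (suc x) (s≤s lt) = cong suc (pIn-lt b x lt)

pIn-ge : ∀ {n} (b : Fin (suc n)) (x : Fin n) → toℕ b ≤ toℕ x → toℕ (punchIn b x) ≡ suc (toℕ x)
pIn-ge zero x _ = refl
pIn-ge (suc b) (suc x) (s≤s le) = cong suc (pIn-ge b x le)

pIn-mono : ∀ {n} (b : Fin (suc n)) (x y : Fin n) → (toℕ (punchIn b x) < toℕ (punchIn b y)) → toℕ x < toℕ y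
pIn-mono b x y lt = ≰⇒> (λ y≤x → <⇒≱ lt (FinP.punchIn-mono-≤ b y x y≤x))

pIn-mono' : ∀ {n} (b : Fin (suc n)) (x y : Fin n) → toℕ x < toℕ y → (toℕ (punchIn b x) < toℕ (punchIn b y))
pIn-mono' b x y lt = ≤∧≢⇒< (FinP.punchIn-mono-≤ b x y (<⇒≤ lt))
  (λ e → <-irrefl (cong toℕ (FinP.punchIn-injective b x y (FinP.toℕ-injective e))) lt)

pIn-b< : ∀ {n} (b : Fin (suc n)) (x : Fin n) → (toℕ b < toℕ (punchIn b x)) → toℕ b ≤ toℕ x
pIn-b< b x lt with toℕ x <? toℕ b
... | yes a = ⊥-elim (<-asym a (subst (toℕ b <_) (pIn-lt b x a) lt))
... | no a = ≮⇒≥ a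

pIn-b<' : ∀ {n} (b : Fin (suc n)) (x : Fin n) → toℕ b ≤ toℕ x → (toℕ b < toℕ (punchIn b x))
pIn-b<' b x le = subst (toℕ b <_) (sym (pIn-ge b x le)) (s≤s le)

pIn-<b : ∀ {n} (b : Fin (suc n)) (x : Fin n) → (toℕ (punchIn b x) < toℕ b) → toℕ x < toℕ b
pIn-<b b x lt with toℕ x <? toℕ b
... | yes a = a
... | no a = ⊥-elim (<-asym lt (subst (toℕ b <_) (sym (pIn-ge b x (≮⇒≥ a))) (s≤s (≮⇒≥ a))))

pIn-<b' : ∀ {n} (b : Fin (suc n)) (x : Fin n) → toℕ x < toℕ b → (toℕ (punchIn b x) < toℕ b)
pIn-<b' b x lt = subst (_< toℕ b) (sym (pIn-lt b x lt)) lt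

Σᶠ-punchIn : ∀ n (b : Fin (suc n)) (F : Fin (suc n) → ℕ) → Σᶠ (suc n) F ≡ F b + Σᶠ n (λ j → F (punchIn b j))
Σᶠ-punchIn n zero F = refl
Σᶠ-punchIn (suc n) (suc b) F = begin
    F zero + Σᶠ (suc n) (λ i → F (suc i))
  ≡⟨ cong (F zero +_) (Σᶠ-punchIn n b (λ i → F (suc i))) ⟩
    F zero + (F (suc b) + Σᶠ n (λ j → F (suc (punchIn b j))))
  ≡⟨ sym (+-assoc (F zero) _ _) ⟩
    (F zero + F (suc b)) + Σᶠ n (λ j → F (suc (punchIn b j)))
  ≡⟨ cong (_+ Σᶠ n (λ j → F (suc (punchIn b j)))) (+-comm (F zero) (F (suc b))) ⟩
    (F (suc b) + F zero) + Σᶠ n (λ j → F (suc (punchIn b j)))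
  ≡⟨ +-assoc (F (suc b)) _ _ ⟩
    F (suc b) + Σᶠ (suc n) (λ j → F (punchIn (suc b) j)) ∎

count-lt : ∀ n c → c ≤ n → Σᶠ n (λ v → ind (toℕ v <? c)) ≡ c
count-lt n zero _ = trans (Σᶠ-cong n (λ v → ind-no (toℕ v <? 0) (λ ()))) (Σᶠ-0 n)
count-lt (suc n) (suc c) (s≤s le) = cong suc (trans (Σᶠ-cong n (λ v → ind-iff (suc (toℕ v) <? suc c) (toℕ v <? c) s≤s⁻¹ s≤s)) (count-lt n c le))

punchIn-cover : ∀ {n} (b i : Fin (suc n)) → (i ≡ b) ⊎ (∃ λ j → punchIn b j ≡ i)
punchIn-cover b i with b FinP.≟ i
... | yes e = inj₁ (sym e)
... | no ne = inj₂ (punchOut ne , FinP.punchIn-punchOut ne)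

lt+ge≡1 : ∀ (x c : ℕ) → ind (x <? c) + ind (c ≤? x) ≡ 1
lt+ge≡1 x c with x <? c | c ≤? x
... | yes a | yes d = ⊥-elim (<⇒≱ a d)
... | yes a | no d = refl
... | no a | yes d = refl
... | no a | no d = ⊥-elim (a (≰⇒> d))

FixedExactlyAt : ∀ {M} → Fin M → Vec (Fin M) M → Set
FixedExactlyAt b σ = lookup σ b ≡ b × FixedOnlyAt b σ

fixedExactlyAt? : ∀ {M} (b : Fin M) (σ : Vec (Fin M) M) → Dec (FixedExactlyAt b σ)
fixedExactlyAt? b σ = (lookup σ b FinP.≟ b) ×-dec fixedOnlyAt? b σ

module InsertFixed (N : ℕ) (b : Fin (suc N)) where
  insertFixed : Vec (Fin N) N → Vec (Fin (suc N)) (suc N)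
  insertFixed ρ = insertAt (V.map (punchIn b) ρ) b b

  insertFixed-b : ∀ ρ → lookup (insertFixed ρ) b ≡ b
  insertFixed-b ρ = VecP.insertAt-lookup (V.map (punchIn b) ρ) b b

  insertFixed-punchIn : ∀ ρ j → lookup (insertFixed ρ) (punchIn b j) ≡ punchIn b (lookup ρ j)
  insertFixed-punchIn ρ j = trans (VecP.insertAt-punchIn (V.map (punchIn b) ρ) b b j) (VecP.lookup-map j (punchIn b) ρ)

  punchOutOr : Fin N → Fin (suc N) → Fin N
  punchOutOr d x with b FinP.≟ x
  ... | yes _ = d
  ... | no ne = punchOut ne

  punchIn-punchOutOr : ∀ d x → x ≢ b → punchIn b (punchOutOr d x) ≡ x
  punchIn-punchOutOr d x nx with b FinP.≟ x
  ... | yes e = ⊥-elim (nx (sym e))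
  ... | no ne = FinP.punchIn-punchOut ne

  punchOutOr-punchIn : ∀ d y → punchOutOr d (punchIn b y) ≡ y
  punchOutOr-punchIn d y with b FinP.≟ punchIn b y
  ... | yes e = ⊥-elim (FinP.punchInᵢ≢i b y (sym e))
  ... | no ne = trans (FinP.punchOut-cong b refl) (FinP.punchOut-punchIn b)

  deleteFixed : Vec (Fin (suc N)) (suc N) → Vec (Fin N) N
  deleteFixed σ = tabulate (λ j → punchOutOr j (lookup σ (punchIn b j)))

  lookup-deleteFixed : ∀ σ j → lookup (deleteFixed σ) j ≡ punchOutOr j (lookup σ (punchIn b j))
  lookup-deleteFixed σ j = VecP.lookup∘tabulate (λ j → punchOutOr j (lookup σ (punchIn b j))) j

  FixesExactly : Vec (Fin (suc N)) (suc N) → Set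
  FixesExactly σ = IsPerm σ × FixedExactlyAt b σ

  fixesExactly? : Decidable FixesExactly
  fixesExactly? σ = isPerm? σ ×-dec fixedExactlyAt? b σ

  avoids-b : ∀ σ → FixesExactly σ → ∀ j → lookup σ (punchIn b j) ≢ b
  avoids-b σ (perm , fb , _) j e = FinP.punchInᵢ≢i b j (uniq⇒inj σ perm _ _ (trans e (sym fb)))

  punchIn-deleteFixed : ∀ σ → FixesExactly σ → ∀ j → punchIn b (lookup (deleteFixed σ) j) ≡ lookup σ (punchIn b j)
  punchIn-deleteFixed σ p j = trans (cong (punchIn b) (lookup-deleteFixed σ j)) (punchIn-punchOutOr j _ (avoids-b σ p j))

  insertFixed-deleteFixed : ∀ σ → FixesExactly σ → insertFixed (deleteFixed σ) ≡ σ
  insertFixed-deleteFixed σ p@(perm , fb , _) = vec-ext _ _ entry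
    where
    entry : ∀ i → lookup (insertFixed (deleteFixed σ)) i ≡ lookup σ i
    entry i with punchIn-cover b i
    ... | inj₁ refl = trans (insertFixed-b (deleteFixed σ)) (sym fb)
    ... | inj₂ (j , refl) = trans (insertFixed-punchIn (deleteFixed σ) j) (punchIn-deleteFixed σ p j)

  deleteFixed-insertFixed : ∀ ρ → IsDerPerm ρ → deleteFixed (insertFixed ρ) ≡ ρ
  deleteFixed-insertFixed ρ _ = vec-ext _ _ (λ j → trans (lookup-deleteFixed (insertFixed ρ) j) (trans (cong (punchOutOr j) (insertFixed-punchIn ρ j)) (punchOutOr-punchIn j (lookup ρ j))))

  deleteFixed-derangement : ∀ σ → FixesExactly σ → IsDerPerm (deleteFixed σ)
  deleteFixed-derangement σ p@(perm , fb , fix) = inj⇒uniq _ inj , der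
    where
    inj : Inj (deleteFixed σ)
    inj j k e = FinP.punchIn-injective b j k (uniq⇒inj σ perm _ _
                  (trans (sym (punchIn-deleteFixed σ p j)) (trans (cong (punchIn b) e) (punchIn-deleteFixed σ p k))))
    der : IsDerangement (deleteFixed σ)
    der j e = avoids-b σ p j (fix _ (trans (sym (punchIn-deleteFixed σ p j)) (cong (punchIn b) e)))

  insertFixed-fixesExactly : ∀ ρ → IsDerPerm ρ → FixesExactly (insertFixed ρ)
  insertFixed-fixesExactly ρ (perm , der) = inj⇒uniq _ inj , insertFixed-b ρ , fix
    where
    σ = insertFixed ρ
    inj : Inj σ
    inj i k e with punchIn-cover b i | punchIn-cover b k
    ... | inj₁ refl | inj₁ refl = refl
    ... | inj₁ refl | inj₂ (j , refl) = ⊥-elim (FinP.punchInᵢ≢i b _ (sym (trans (sym (insertFixed-b ρ)) (trans e (insertFixed-punchIn ρ j)))))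
    ... | inj₂ (j , refl) | inj₁ refl = ⊥-elim (FinP.punchInᵢ≢i b _ (trans (sym (insertFixed-punchIn ρ j)) (trans e (insertFixed-b ρ))))
    ... | inj₂ (j , refl) | inj₂ (j' , refl) = cong (punchIn b) (uniq⇒inj ρ perm j j'
          (FinP.punchIn-injective b _ _ (trans (sym (insertFixed-punchIn ρ j)) (trans e (insertFixed-punchIn ρ j')))))
    fix : FixedOnlyAt b σ
    fix i e with punchIn-cover b i
    ... | inj₁ refl = insertFixed-b ρ
    ... | inj₂ (j , refl) = ⊥-elim (der j (FinP.punchIn-injective b _ _ (trans (sym (insertFixed-punchIn ρ j)) e)))

  -- The fixed point is not an excedance and punchIn b preserves the others.
  exc-insertFixed : ∀ ρ → excS (insertFixed ρ) ≡ excS ρ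
  exc-insertFixed ρ = begin
      excS (insertFixed ρ)
    ≡⟨ Σᶠ-punchIn N b (λ i → ind (toℕ i <? toℕ (lookup (insertFixed ρ) i))) ⟩
      ind (toℕ b <? toℕ (lookup (insertFixed ρ) b)) + Σᶠ N (λ j → ind (toℕ (punchIn b j) <? toℕ (lookup (insertFixed ρ) (punchIn b j))))
    ≡⟨ cong₂ _+_ (ind-no (toℕ b <? toℕ (lookup (insertFixed ρ) b)) (λ lt → <-irrefl (cong toℕ (sym (insertFixed-b ρ))) lt))
         (Σᶠ-cong N (λ j → trans (cong (λ z → ind (toℕ (punchIn b j) <? toℕ z)) (insertFixed-punchIn ρ j))
             (ind-iff (toℕ (punchIn b j) <? toℕ (punchIn b (lookup ρ j))) (toℕ j <? toℕ (lookup ρ j))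
               (pIn-mono b j (lookup ρ j)) (pIn-mono' b j (lookup ρ j))))) ⟩
      excS ρ ∎

  ind-b<punchIn : ∀ x → ind (toℕ b <? toℕ (punchIn b x)) ≡ ind (toℕ b ≤? toℕ x)
  ind-b<punchIn x = ind-iff (toℕ b <? toℕ (punchIn b x)) (toℕ b ≤? toℕ x) (pIn-b< b x) (pIn-b<' b x)
  ind-punchIn<b : ∀ x → ind (toℕ (punchIn b x) <? toℕ b) ≡ ind (toℕ x <? toℕ b)
  ind-punchIn<b x = ind-iff (toℕ (punchIn b x) <? toℕ b) (toℕ x <? toℕ b) (pIn-<b b x) (pIn-<b' b x)
  ind-punchIn-mono : ∀ x y → ind (toℕ (punchIn b x) <? toℕ (punchIn b y)) ≡ ind (toℕ x <? toℕ y)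
  ind-punchIn-mono x y = ind-iff (toℕ (punchIn b x) <? toℕ (punchIn b y)) (toℕ x <? toℕ y) (pIn-mono b x y) (pIn-mono' b x y)

  -- Inversions of insertFixed ρ: besides those of ρ, the pairs through position b
  -- contribute X (positions after b with values below b) and Y (positions
  -- before b with values above b).  With W the positions before b with values
  -- below b, X + W counts the values below b and Y + W the positions below b;
  -- both are b, so X = Y and inv (insertFixed ρ) = inv ρ + 2X: parity is kept.
  module InsertFixedInversions (ρ : Vec (Fin N) N) (ρinj : Inj ρ) where
    σ = insertFixed ρ
    ltb geb : Fin N → ℕ
    ltb v = ind (toℕ v <? toℕ b)
    geb v = ind (toℕ b ≤? toℕ v)
    X Y W : ℕ
    X = Σᶠ N (λ r → geb r * ltb (lookup ρ r))
    Y = Σᶠ N (λ q → ltb q * geb (lookup ρ q))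
    W = Σᶠ N (λ r → ltb r * ltb (lookup ρ r))

    b≤N : toℕ b ≤ N
    b≤N = s≤s⁻¹ (FinP.toℕ<n b)

    W+X : W + X ≡ toℕ b
    W+X = begin
        W + X
      ≡⟨ sym (Σᶠ-+ N (λ r → ltb r * ltb (lookup ρ r)) (λ r → geb r * ltb (lookup ρ r))) ⟩
        Σᶠ N (λ r → ltb r * ltb (lookup ρ r) + geb r * ltb (lookup ρ r))
      ≡⟨ Σᶠ-cong N (λ r → trans (sym (*-distribʳ-+ (ltb (lookup ρ r)) (ltb r) (geb r)))
                         (trans (cong (_* ltb (lookup ρ r)) (lt+ge≡1 (toℕ r) (toℕ b))) (+-identityʳ _))) ⟩
        Σᶠ N (λ r → ltb (lookup ρ r))
      ≡⟨ Σᶠ-permute ρ ρinj ltb ⟩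
        Σᶠ N ltb
      ≡⟨ count-lt N (toℕ b) b≤N ⟩
        toℕ b ∎

    W+Y : W + Y ≡ toℕ b
    W+Y = begin
        W + Y
      ≡⟨ sym (Σᶠ-+ N (λ r → ltb r * ltb (lookup ρ r)) (λ q → ltb q * geb (lookup ρ q))) ⟩
        Σᶠ N (λ q → ltb q * ltb (lookup ρ q) + ltb q * geb (lookup ρ q))
      ≡⟨ Σᶠ-cong N (λ q → trans (sym (*-distribˡ-+ (ltb q) (ltb (lookup ρ q)) (geb (lookup ρ q))))
                         (trans (cong (ltb q *_) (lt+ge≡1 (toℕ (lookup ρ q)) (toℕ b))) (*-identityʳ _))) ⟩
        Σᶠ N ltb
      ≡⟨ count-lt N (toℕ b) b≤N ⟩
        toℕ b ∎

    X≡Y : X ≡ Y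
    X≡Y = +-cancelˡ-≡ W X Y (trans W+X (sym W+Y))

    L : ∀ {m} → Fin m → Fin m → ℕ
    L q r = ind (toℕ q <? toℕ r)

    row : Fin (suc N) → ℕ
    row q = Σᶠ (suc N) (λ r → L q r * ind (toℕ (lookup σ r) <? toℕ (lookup σ q)))

    row-b : row b ≡ X
    row-b = begin
        row b
      ≡⟨ Σᶠ-punchIn N b (λ r → L b r * ind (toℕ (lookup σ r) <? toℕ (lookup σ b))) ⟩
        L b b * ind (toℕ (lookup σ b) <? toℕ (lookup σ b)) + Σᶠ N (λ r → L b (punchIn b r) * ind (toℕ (lookup σ (punchIn b r)) <? toℕ (lookup σ b)))
      ≡⟨ cong₂ _+_ (cong (_* ind (toℕ (lookup σ b) <? toℕ (lookup σ b))) (ind-no (toℕ b <? toℕ b) (<-irrefl refl)))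
           (Σᶠ-cong N (λ r → cong₂ _*_ (ind-b<punchIn r)
              (trans (cong₂ (λ u w → ind (toℕ u <? toℕ w)) (insertFixed-punchIn ρ r) (insertFixed-b ρ)) (ind-punchIn<b (lookup ρ r))))) ⟩
        X ∎

    row-punchIn : ∀ j → row (punchIn b j) ≡ ltb j * geb (lookup ρ j) + Σᶠ N (λ r → L j r * ind (toℕ (lookup ρ r) <? toℕ (lookup ρ j)))
    row-punchIn j = begin
        row (punchIn b j)
      ≡⟨ Σᶠ-punchIn N b (λ r → L (punchIn b j) r * ind (toℕ (lookup σ r) <? toℕ (lookup σ (punchIn b j)))) ⟩
        L (punchIn b j) b * ind (toℕ (lookup σ b) <? toℕ (lookup σ (punchIn b j)))
          + Σᶠ N (λ r → L (punchIn b j) (punchIn b r) * ind (toℕ (lookup σ (punchIn b r)) <? toℕ (lookup σ (punchIn b j))))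
      ≡⟨ cong₂ _+_ (cong₂ _*_ (ind-punchIn<b j) (trans (cong₂ (λ u w → ind (toℕ u <? toℕ w)) (insertFixed-b ρ) (insertFixed-punchIn ρ j)) (ind-b<punchIn (lookup ρ j))))
           (Σᶠ-cong N (λ r → cong₂ _*_ (ind-punchIn-mono j r)
              (trans (cong₂ (λ u w → ind (toℕ u <? toℕ w)) (insertFixed-punchIn ρ r) (insertFixed-punchIn ρ j)) (ind-punchIn-mono (lookup ρ r) (lookup ρ j))))) ⟩
        ltb j * geb (lookup ρ j) + Σᶠ N (λ r → L j r * ind (toℕ (lookup ρ r) <? toℕ (lookup ρ j))) ∎

    invS-insertFixed : invS σ ≡ invS ρ + 2 * X
    invS-insertFixed = begin
        invS σ
      ≡⟨ Σᶠ-punchIn N b row ⟩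
        row b + Σᶠ N (λ j → row (punchIn b j))
      ≡⟨ cong₂ _+_ row-b (trans (Σᶠ-cong N row-punchIn) (Σᶠ-+ N (λ j → ltb j * geb (lookup ρ j)) (λ j → Σᶠ N (λ r → L j r * ind (toℕ (lookup ρ r) <? toℕ (lookup ρ j)))))) ⟩
        X + (Y + invS ρ)
      ≡⟨ cong (λ z → X + (z + invS ρ)) (sym X≡Y) ⟩
        X + (X + invS ρ)
      ≡⟨ trans (sym (+-assoc X X (invS ρ))) (+-comm (X + X) (invS ρ)) ⟩
        invS ρ + (X + X)
      ≡⟨ cong (λ z → invS ρ + (X + z)) (sym (+-identityʳ X)) ⟩
        invS ρ + 2 * X ∎

  parity-insertFixed : ∀ ρ → IsDerPerm ρ → parity (insertFixed ρ) ≡ parity ρ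
  parity-insertFixed ρ (perm , _) = begin
      evenᵇ (inv (insertFixed ρ))
    ≡⟨ cong evenᵇ (trans (inv≡ (insertFixed ρ)) (InsertFixedInversions.invS-insertFixed ρ (uniq⇒inj ρ perm))) ⟩
      evenᵇ (invS ρ + 2 * InsertFixedInversions.X ρ (uniq⇒inj ρ perm))
    ≡⟨ evenᵇ-+2* (invS ρ) (InsertFixedInversions.X ρ (uniq⇒inj ρ perm)) ⟩
      evenᵇ (invS ρ)
    ≡⟨ cong evenᵇ (sym (inv≡ ρ)) ⟩
      parity ρ ∎

  module InsertFixedCount (Ψ : ℕ → Bool → ℕ) where
    fixedWeight : Vec (Fin (suc N)) (suc N) → ℕ
    fixedWeight σ = ind (isPerm? σ) * (ind (fixedExactlyAt? b σ) * Ψ (exc σ) (parity σ))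

    derWeight : Vec (Fin N) N → ℕ
    derWeight ρ = ind (isPerm? ρ) * (ind (isDerangement? ρ) * Ψ (exc ρ) (parity ρ))

    fixedWeight-outside : ∀ σ → ¬ FixesExactly σ → fixedWeight σ ≡ 0
    fixedWeight-outside σ np with isPerm? σ | fixedExactlyAt? b σ
    ... | yes p | yes d = ⊥-elim (np (p , d))
    ... | yes p | no _ = refl
    ... | no _ | _ = refl

    derWeight-outside : ∀ ρ → ¬ IsDerPerm ρ → derWeight ρ ≡ 0
    derWeight-outside ρ nq with isPerm? ρ | isDerangement? ρ
    ... | yes p | yes d = ⊥-elim (nq (p , d))
    ... | yes p | no _ = refl
    ... | no _ | _ = refl

    weights-agree : ∀ ρ → IsDerPerm ρ → derWeight ρ ≡ fixedWeight (insertFixed ρ)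
    weights-agree ρ q@(perm , der) = begin
        ind (isPerm? ρ) * (ind (isDerangement? ρ) * Ψ (exc ρ) (parity ρ))
      ≡⟨ cong₂ (λ u w → u * (w * Ψ (exc ρ) (parity ρ))) (ind-yes (isPerm? ρ) perm) (ind-yes (isDerangement? ρ) der) ⟩
        1 * (1 * Ψ (exc ρ) (parity ρ))
      ≡⟨ cong₂ (λ u w → 1 * (1 * Ψ u w)) (sym (trans (exc≡ σ) (trans (exc-insertFixed ρ) (sym (exc≡ ρ))))) (sym (parity-insertFixed ρ q)) ⟩
        1 * (1 * Ψ (exc σ) (parity σ))
      ≡⟨ cong₂ (λ u w → u * (w * Ψ (exc σ) (parity σ))) (sym (ind-yes (isPerm? σ) (proj₁ (insertFixed-fixesExactly ρ q)))) (sym (ind-yes (fixedExactlyAt? b σ) (proj₂ (insertFixed-fixesExactly ρ q)))) ⟩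
        fixedWeight σ ∎
      where σ = insertFixed ρ

    derSum-insertFixed : derSum N Ψ ≡ ΣV (suc N) (suc N) fixedWeight
    derSum-insertFixed =
      sum-bijection (sumVec (suc N) (suc N)) (sumVec N N) FixesExactly IsDerPerm fixesExactly?
        deleteFixed insertFixed fixedWeight derWeight
        insertFixed-deleteFixed deleteFixed-insertFixed deleteFixed-derangement
        fixedWeight-outside weights-agree derWeight-outside isDerPerm?

Σᶠ-mono : ∀ n (f g : Fin n → ℕ) → (∀ i → f i ≤ g i) → Σᶠ n f ≤ Σᶠ n g
Σᶠ-mono zero f g h = z≤n
Σᶠ-mono (suc n) f g h = +-mono-≤ (h zero) (Σᶠ-mono n (λ i → f (suc i)) (λ i → g (suc i)) (λ i → h (suc i)))

Σᶠ-const : ∀ n c → Σᶠ n (λ _ → c) ≡ n * c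
Σᶠ-const zero c = refl
Σᶠ-const (suc n) c = cong (c +_) (Σᶠ-const n c)

fix-split : ∀ {M} (b : Fin M) (σ : Vec (Fin M) M) → ind (fixedOnlyAt? b σ) ≡ ind (isDerangement? σ) + ind (fixedExactlyAt? b σ)
fix-split b σ = cases (lookup σ b FinP.≟ b)
  where
  cases : Dec (lookup σ b ≡ b) → ind (fixedOnlyAt? b σ) ≡ ind (isDerangement? σ) + ind (fixedExactlyAt? b σ)
  cases (yes fixed) = trans (ind-iff (fixedOnlyAt? b σ) (fixedExactlyAt? b σ) (λ f → fixed , f) proj₂)
                            (cong (_+ ind (fixedExactlyAt? b σ)) (sym (ind-no (isDerangement? σ) (λ d → d b fixed))))
  cases (no moved) = trans (ind-iff (fixedOnlyAt? b σ) (isDerangement? σ)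
                             (λ f q e → moved (subst (λ z → lookup σ z ≡ b) (trans (sym e) (f q e)) (f q e)))
                             (λ d q e → ⊥-elim (d q e)))
                      (sym (trans (cong (ind (isDerangement? σ) +_) (ind-no (fixedExactlyAt? b σ) (λ fe → moved (proj₁ fe)))) (+-identityʳ _)))

-- Since every
-- value is taken once, Σ_b hits b = exc σ.
module ExcedanceTargets {M : ℕ} (σ : Vec (Fin M) M) (σinj : Inj σ) where
  excAt : Fin M → ℕ
  excAt q = ind (toℕ q <? toℕ (lookup σ q))
  hits : Fin M → ℕ
  hits b = Σᶠ M (λ q → excAt q * ind (lookup σ q FinP.≟ b))

  excAvoiding+hits : ∀ b → excAvoiding b σ + hits b ≡ excS σ
  excAvoiding+hits b = trans (sym (Σᶠ-+ M (λ q → excAt q * ind (¬? (lookup σ q FinP.≟ b))) (λ q → excAt q * ind (lookup σ q FinP.≟ b))))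
    (Σᶠ-cong M (λ q → trans (sym (*-distribˡ-+ (excAt q) _ _)) (trans (cong (excAt q *_) (ind¬+ind (lookup σ q FinP.≟ b))) (*-identityʳ (excAt q)))))

  hits≤1 : ∀ b → hits b ≤ 1
  hits≤1 b = ≤-trans (Σᶠ-mono M _ (λ q → ind (lookup σ q FinP.≟ b)) (λ q → ≤-trans (*-monoˡ-≤ (ind (lookup σ q FinP.≟ b)) (ind≤1 (toℕ q <? toℕ (lookup σ q)))) (≤-reflexive (*-identityˡ _))))
                     (≤-reflexive (preimage-count σ σinj b))

  Σhits : Σᶠ M hits ≡ excS σ
  Σhits = begin
      Σᶠ M hits
    ≡⟨ sym (Σᶠ-comm M (linFin M) (λ q b → excAt q * ind (lookup σ q FinP.≟ b))) ⟩
      Σᶠ M (λ q → Σᶠ M (λ b → excAt q * ind (lookup σ q FinP.≟ b)))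
    ≡⟨ Σᶠ-cong M (λ q → trans (Σᶠ-cong M (λ b → *-comm (excAt q) _)) (Summation.delta-f' (sumFin M) (lookup σ q) (λ _ → excAt q))) ⟩
      excS σ ∎

  Σ[1∸hits] : Σᶠ M (λ b → 1 ∸ hits b) ≡ M ∸ excS σ
  Σ[1∸hits] = begin
      Σᶠ M (λ b → 1 ∸ hits b)
    ≡⟨ sym (m+n∸n≡m _ (Σᶠ M hits)) ⟩
      (Σᶠ M (λ b → 1 ∸ hits b) + Σᶠ M hits) ∸ Σᶠ M hits
    ≡⟨ cong₂ _∸_ (trans (sym (Σᶠ-+ M (λ b → 1 ∸ hits b) hits)) (trans (Σᶠ-cong M (λ b → m∸n+n≡m (hits≤1 b))) (Σᶠ-const1 M))) Σhits ⟩
      M ∸ excS σ ∎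

  -- Summing Φ(1 + excAvoiding b σ) over b: the exc σ values hit by an excedance
  -- contribute Φ(exc σ), the other M - exc σ values contribute Φ(exc σ + 1).
  module _ (Φ : ℕ → Bool → ℕ) (s : Bool) where
    excAvoiding-cases : ∀ b → Φ (suc (excAvoiding b σ)) s ≡ hits b * Φ (excS σ) s + (1 ∸ hits b) * Φ (suc (excS σ)) s
    excAvoiding-cases b with hits b | hits≤1 b | excAvoiding+hits b
    ... | zero | _ | e = trans (cong (λ z → Φ (suc z) s) (trans (sym (+-identityʳ (excAvoiding b σ))) e)) (sym (+-identityʳ _))
    ... | suc zero | _ | e = trans (cong (λ z → Φ z s) (trans (+-comm 1 (excAvoiding b σ)) e)) (sym (trans (+-identityʳ _) (+-identityʳ _)))
    ... | suc (suc _) | s≤s () | _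

    Σ-excAvoiding : Σᶠ M (λ b → Φ (suc (excAvoiding b σ)) s) ≡ excS σ * Φ (excS σ) s + (M ∸ excS σ) * Φ (suc (excS σ)) s
    Σ-excAvoiding = begin
        Σᶠ M (λ b → Φ (suc (excAvoiding b σ)) s)
      ≡⟨ trans (Σᶠ-cong M excAvoiding-cases) (Σᶠ-+ M (λ b → hits b * Φ (excS σ) s) (λ b → (1 ∸ hits b) * Φ (suc (excS σ)) s)) ⟩
        Σᶠ M (λ b → hits b * Φ (excS σ) s) + Σᶠ M (λ b → (1 ∸ hits b) * Φ (suc (excS σ)) s)
      ≡⟨ cong₂ _+_ (trans (LinearSumProps.S-scalʳ (linFin M) (Φ (excS σ) s) hits) (cong (_* Φ (excS σ) s) Σhits))
                    (trans (LinearSumProps.S-scalʳ (linFin M) (Φ (suc (excS σ)) s) (λ b → 1 ∸ hits b)) (cong (_* Φ (suc (excS σ)) s) Σ[1∸hits])) ⟩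
        excS σ * Φ (excS σ) s + (M ∸ excS σ) * Φ (suc (excS σ)) s ∎

excAvoiding-fixed : ∀ {M} (b : Fin M) (σ : Vec (Fin M) M) → Inj σ → lookup σ b ≡ b → excAvoiding b σ ≡ excS σ
excAvoiding-fixed {M} b σ inj fixed = Σᶠ-cong M avoids
  where
  avoids : ∀ q → ind (toℕ q <? toℕ (lookup σ q)) * ind (¬? (lookup σ q FinP.≟ b)) ≡ ind (toℕ q <? toℕ (lookup σ q))
  avoids q with lookup σ q FinP.≟ b
  ... | no _ = *-identityʳ _
  ... | yes e with inj q b (trans e (sym fixed))
  ...   | refl = trans (*-zeroʳ (ind (toℕ q <? toℕ (lookup σ q)))) (sym (ind-no (toℕ q <? toℕ (lookup σ q)) (λ lt → <-irrefl (cong toℕ (sym e)) lt)))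

module Recurrence (N : ℕ) (Φ : ℕ → Bool → ℕ) where
  private
    M = suc N
  open AttachCount N Φ using (pairWeight; derSum-attach)

  contractedWeight derPart fixedPart : Fin M → Vec (Fin M) M → ℕ
  contractedWeight b σ = Φ (suc (excAvoiding b σ)) (not (parity σ))
  derPart b σ = ind (isPerm? σ) * (ind (isDerangement? σ) * contractedWeight b σ)
  fixedPart b σ = ind (isPerm? σ) * (ind (fixedExactlyAt? b σ) * contractedWeight b σ)

  pairWeight-split : ∀ b σ → pairWeight (b , σ) ≡ derPart b σ + fixedPart b σ
  pairWeight-split b σ = begin
      ind (isPerm? σ) * (ind (fixedOnlyAt? b σ) * contractedWeight b σ)
    ≡⟨ cong (λ z → ind (isPerm? σ) * (z * contractedWeight b σ)) (fix-split b σ) ⟩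
      ind (isPerm? σ) * ((ind (isDerangement? σ) + ind (fixedExactlyAt? b σ)) * contractedWeight b σ)
    ≡⟨ cong (ind (isPerm? σ) *_) (*-distribʳ-+ (contractedWeight b σ) (ind (isDerangement? σ)) (ind (fixedExactlyAt? b σ))) ⟩
      ind (isPerm? σ) * (ind (isDerangement? σ) * contractedWeight b σ + ind (fixedExactlyAt? b σ) * contractedWeight b σ)
    ≡⟨ *-distribˡ-+ (ind (isPerm? σ)) _ _ ⟩
      derPart b σ + fixedPart b σ ∎

  derPart-sum : Σᶠ M (λ b → ΣV M M (derPart b)) ≡ derSum M (λ e s → e * Φ e (not s) + (M ∸ e) * Φ (suc e) (not s))
  derPart-sum = begin
      Σᶠ M (λ b → ΣV M M (derPart b))
    ≡⟨ Σᶠ-comm M (linVec M M) derPart ⟩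
      ΣV M M (λ σ → Σᶠ M (λ b → derPart b σ))
    ≡⟨ ΣV-cong M M (λ σ → trans (LinearSumProps.S-scal (linFin M) (ind (isPerm? σ)) (λ b → ind (isDerangement? σ) * contractedWeight b σ))
                       (cong (ind (isPerm? σ) *_) (LinearSumProps.S-scal (linFin M) (ind (isDerangement? σ)) (λ b → contractedWeight b σ)))) ⟩
      ΣV M M (λ σ → ind (isPerm? σ) * (ind (isDerangement? σ) * Σᶠ M (λ b → contractedWeight b σ)))
    ≡⟨ ΣV-cong M M sum-over-b ⟩
      derSum M (λ e s → e * Φ e (not s) + (M ∸ e) * Φ (suc e) (not s)) ∎
    where
    sum-over-b : ∀ σ → ind (isPerm? σ) * (ind (isDerangement? σ) * Σᶠ M (λ b → contractedWeight b σ))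
                     ≡ ind (isPerm? σ) * (ind (isDerangement? σ) * (exc σ * Φ (exc σ) (not (parity σ)) + (M ∸ exc σ) * Φ (suc (exc σ)) (not (parity σ))))
    sum-over-b σ with isPerm? σ
    ... | no _ = refl
    ... | yes p = cong (λ z → 1 * (ind (isDerangement? σ) * z))
                    (trans (ExcedanceTargets.Σ-excAvoiding σ (uniq⇒inj σ p) Φ (not (parity σ)))
                           (cong (λ e → e * Φ e (not (parity σ)) + (M ∸ e) * Φ (suc e) (not (parity σ))) (sym (exc≡ σ))))

  fixedPart-sum : Σᶠ M (λ b → ΣV M M (fixedPart b)) ≡ M * derSum N (λ e s → Φ (suc e) (not s))
  fixedPart-sum = trans (Σᶠ-cong M (λ b → trans (ΣV-cong M M (as-fixedWeight b)) (sym (InsertFixed.InsertFixedCount.derSum-insertFixed N b shifted))))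
                        (Σᶠ-const M (derSum N shifted))
    where
    shifted : ℕ → Bool → ℕ
    shifted e s = Φ (suc e) (not s)
    as-fixedWeight : ∀ b σ → fixedPart b σ ≡ InsertFixed.InsertFixedCount.fixedWeight N b shifted σ
    as-fixedWeight b σ with isPerm? σ | fixedExactlyAt? b σ
    ... | no _ | _ = refl
    ... | yes _ | no _ = refl
    ... | yes p | yes (fixed , _) = cong (λ e → 1 * (1 * Φ (suc e) (not (parity σ))))
                                     (trans (excAvoiding-fixed b σ (uniq⇒inj σ p) fixed) (sym (exc≡ σ)))

  derSum-recurrence : derSum (suc M) Φ ≡
    derSum M (λ e s → e * Φ e (not s) + (M ∸ e) * Φ (suc e) (not s)) + M * derSum N (λ e s → Φ (suc e) (not s))
  derSum-recurrence = begin
      derSum (suc M) Φ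
    ≡⟨ derSum-attach ⟩
      Σᶠ M (λ b → ΣV M M (λ σ → pairWeight (b , σ)))
    ≡⟨ Σᶠ-cong M (λ b → ΣV-cong M M (pairWeight-split b)) ⟩
      Σᶠ M (λ b → ΣV M M (λ σ → derPart b σ + fixedPart b σ))
    ≡⟨ trans (Σᶠ-cong M (λ b → ΣV-+ M M (derPart b) (fixedPart b))) (Σᶠ-+ M (λ b → ΣV M M (derPart b)) (λ b → ΣV M M (fixedPart b))) ⟩
      Σᶠ M (λ b → ΣV M M (derPart b)) + Σᶠ M (λ b → ΣV M M (fixedPart b))
    ≡⟨ cong₂ _+_ derPart-sum fixedPart-sum ⟩
      derSum M (λ e s → e * Φ e (not s) + (M ∸ e) * Φ (suc e) (not s)) + M * derSum N (λ e s → Φ (suc e) (not s)) ∎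

open Recurrence public using (derSum-recurrence)

-- Binomial coefficients defined by Pascal's rule, the recursion the coefficient
-- computations below need; `binom≡C` identifies them with the library's _C_.
binom : ℕ → ℕ → ℕ
binom m zero = 1
binom zero (suc k) = 0
binom (suc m) (suc k) = binom m k + binom m (suc k)

binom≡C : ∀ m k → binom m k ≡ Comb._C_ m k
binom≡C m zero = refl
binom≡C zero (suc k) = sym (k>n⇒nCk≡0 {0} {suc k} (s≤s z≤n))
binom≡C (suc m) (suc k) = trans (cong₂ _+_ (binom≡C m k) (binom≡C m (suc k))) (nCk+nC[k+1]≡[n+1]C[k+1] m k)

binom-big : ∀ m k → m < k → binom m k ≡ 0
binom-big zero (suc k) _ = refl
binom-big (suc m) (suc k) (s≤s lt) = cong₂ _+_ (binom-big m k lt) (binom-big m (suc k) (m≤n⇒m≤1+n lt))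

binom-absorb : ∀ m l → suc l * binom (suc m) (suc l) ≡ suc m * binom m l
binom-absorb zero zero = refl
binom-absorb zero (suc l) = *-zeroʳ (suc (suc l))
binom-absorb (suc m) zero = trans (cong (λ z → 1 * (1 + z)) (choose-1 m)) (arith m)
  where
  choose-1 : ∀ m → binom (suc m) 1 ≡ suc m
  choose-1 zero = refl
  choose-1 (suc m) = cong suc (choose-1 m)
  arith : ∀ m → 1 * (1 + suc m) ≡ suc (suc m) * 1
  arith = solve-∀
binom-absorb (suc m) (suc l) = begin
    suc (suc l) * (c + binom (suc m) (suc (suc l)))
  ≡⟨ split c (binom (suc m) (suc (suc l))) l ⟩
    suc l * c + c + suc (suc l) * binom (suc m) (suc (suc l))
  ≡⟨ cong₂ (λ u w → u + c + w) (binom-absorb m l) (binom-absorb m (suc l)) ⟩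
    suc m * binom m l + c + suc m * binom m (suc l)
  ≡⟨ collect (binom m l) c (binom m (suc l)) m ⟩
    suc m * (binom m l + binom m (suc l)) + c
  ≡⟨ twice c m ⟩
    suc (suc m) * c ∎
  where
  c = binom (suc m) (suc l)
  split : ∀ x y l → suc (suc l) * (x + y) ≡ suc l * x + x + suc (suc l) * y
  split = solve-∀
  collect : ∀ a b c m → suc m * a + b + suc m * c ≡ suc m * (a + c) + b
  collect = solve-∀
  twice : ∀ x m → suc m * x + x ≡ suc (suc m) * x
  twice = solve-∀

binom-absorb′ : ∀ m l → (suc m ∸ l) * binom (suc m) l ≡ suc m * binom m l
binom-absorb′ m zero = refl
binom-absorb′ m (suc l) with m <? l
... | yes lt = trans (cong ((suc m ∸ suc l) *_) (binom-big (suc m) (suc l) (s≤s lt)))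
                 (trans (*-zeroʳ (suc m ∸ suc l)) (sym (trans (cong (suc m *_) (binom-big m (suc l) (m≤n⇒m≤1+n lt))) (*-zeroʳ (suc m)))))
... | no nlt = +-cancelˡ-≡ (suc l * binom (suc m) (suc l)) _ _ (begin
    suc l * binom (suc m) (suc l) + (m ∸ l) * binom (suc m) (suc l)
  ≡⟨ sym (*-distribʳ-+ (binom (suc m) (suc l)) (suc l) (m ∸ l)) ⟩
    (suc l + (m ∸ l)) * binom (suc m) (suc l)
  ≡⟨ cong (_* binom (suc m) (suc l)) (cong suc (m+[n∸m]≡n (≮⇒≥ nlt))) ⟩
    suc m * binom (suc m) (suc l)
  ≡⟨ *-distribˡ-+ (suc m) (binom m l) (binom m (suc l)) ⟩
    suc m * binom m l + suc m * binom m (suc l)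
  ≡⟨ cong (_+ suc m * binom m (suc l)) (sym (binom-absorb m l)) ⟩
    suc l * binom (suc m) (suc l) + suc m * binom m (suc l) ∎)

binom-absorb-sum : ∀ m i → suc i * binom m (suc i) + (m ∸ i) * binom m i ≡ 2 * m * binom (m ∸ 1) i
binom-absorb-sum zero i = trans (cong (λ z → suc i * 0 + z * binom 0 i) (0∸n≡0 i)) (trans (+-identityʳ (suc i * 0)) (*-zeroʳ (suc i)))
binom-absorb-sum (suc m) i = begin
    suc i * binom (suc m) (suc i) + (suc m ∸ i) * binom (suc m) i
  ≡⟨ cong₂ _+_ (binom-absorb m i) (binom-absorb′ m i) ⟩
    suc m * binom m i + suc m * binom m i
  ≡⟨ double (suc m) (binom m i) ⟩
    2 * suc m * binom m i ∎
  where
  double : ∀ a b → a * b + a * b ≡ 2 * a * b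
  double = solve-∀

-- The binomial form of the basis recurrence below (k = j + i, i ≤ m):
-- (k+1) C(m, i+1) + (m+2j-k) C(m, i) = j C(m+1, i+1) + 2m C(m-1, i).
binom-step : ∀ j m i → suc (j + i) * binom m (suc i) + (m + 2 * j ∸ (j + i)) * binom m i
                     ≡ j * binom (suc m) (suc i) + 2 * m * binom (m ∸ 1) i
binom-step j m i with m <? i
... | yes m<i rewrite binom-big m i m<i | binom-big m (suc i) (m≤n⇒m≤1+n m<i)
        | binom-big (m ∸ 1) i (≤-<-trans (m∸n≤m m 1) m<i)
        | *-zeroʳ (suc (j + i)) | *-zeroʳ (m + 2 * j ∸ (j + i)) | *-zeroʳ j | *-zeroʳ (2 * m) = refl
... | no m≮i = begin
    suc (j + i) * binom m (suc i) + (m + 2 * j ∸ (j + i)) * binom m i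
  ≡⟨ cong (λ z → suc (j + i) * binom m (suc i) + z * binom m i) excess ⟩
    suc (j + i) * binom m (suc i) + ((m ∸ i) + j) * binom m i
  ≡⟨ rearrange j i (binom m (suc i)) (m ∸ i) (binom m i) ⟩
    j * (binom m i + binom m (suc i)) + (suc i * binom m (suc i) + (m ∸ i) * binom m i)
  ≡⟨ cong (λ z → j * binom (suc m) (suc i) + z) (binom-absorb-sum m i) ⟩
    j * binom (suc m) (suc i) + 2 * m * binom (m ∸ 1) i ∎
  where
  rearrange : ∀ j i x a y → suc (j + i) * x + (a + j) * y ≡ j * (y + x) + (suc i * x + a * y)
  rearrange = solve-∀
  regroup : ∀ a i j → a + i + 2 * j ≡ (a + j) + (j + i)
  regroup = solve-∀
  excess : m + 2 * j ∸ (j + i) ≡ (m ∸ i) + j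
  excess = begin
      m + 2 * j ∸ (j + i)
    ≡⟨ cong (λ z → z + 2 * j ∸ (j + i)) (sym (m∸n+n≡m (≮⇒≥ m≮i))) ⟩
      (m ∸ i) + i + 2 * j ∸ (j + i)
    ≡⟨ cong (_∸ (j + i)) (regroup (m ∸ i) i j) ⟩
      ((m ∸ i) + j) + (j + i) ∸ (j + i)
    ≡⟨ m+n∸n≡m ((m ∸ i) + j) (j + i) ⟩
      (m ∸ i) + j ∎

basis : ℕ → ℕ → ℕ → ℕ
basis = coeffGammaBasis

basis-below : ∀ j m k → k < j → basis j m k ≡ 0
basis-below j m k k<j with j ≤? k
... | yes j≤k = ⊥-elim (<⇒≱ k<j j≤k)
... | no _ = refl

basis-above : ∀ j m i → basis j m (j + i) ≡ binom m i
basis-above j m i with j ≤? j + i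
... | yes _ = trans (cong (Comb._C_ m) (m+n∸m≡n j i)) (sym (binom≡C m i))
... | no j≰j+i = ⊥-elim (j≰j+i (m≤m+n j i))

data Position (j k : ℕ) : Set where
  below : k < j → Position j k
  above : ∀ i → k ≡ j + i → Position j k

position : ∀ j k → Position j k
position j k with k <? j
... | yes k<j = below k<j
... | no k≮j = above (k ∸ j) (sym (m+[n∸m]≡n (≮⇒≥ k≮j)))

basis-shift : ∀ j m k → basis j m k ≡ basis (suc j) m (suc k)
basis-shift j m k with position j k
... | below k<j = trans (basis-below j m k k<j) (sym (basis-below (suc j) m (suc k) (s≤s k<j)))
... | above i refl = trans (basis-above j m i) (sym (basis-above (suc j) m i))

-- The key identity for the gamma basis: with n = m + 2j and f = t^j (1+t)^m,
--   (k+1) [t^(k+1)] f + (n-k) [t^k] f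
--     = j [t^(k+1)] t^j (1+t)^(m+1) + 2m [t^(k+1)] t^(j+1) (1+t)^(m-1),
-- i.e. the excedance-insertion operator maps t^j(1+t)^m to
-- j t^j(1+t)^(m+1) + 2m t^(j+1)(1+t)^(m-1), shifted by one degree.
basis-step : ∀ j m k → suc k * basis j m (suc k) + (m + 2 * j ∸ k) * basis j m k
                     ≡ j * basis j (suc m) (suc k) + 2 * m * basis (suc j) (m ∸ 1) (suc k)
basis-step j m k with position j k
... | above i refl = begin
    suc (j + i) * basis j m (suc (j + i)) + (m + 2 * j ∸ (j + i)) * basis j m (j + i)
  ≡⟨ cong₂ (λ u w → suc (j + i) * u + (m + 2 * j ∸ (j + i)) * w) (basis-above-suc m) (basis-above j m i) ⟩
    suc (j + i) * binom m (suc i) + (m + 2 * j ∸ (j + i)) * binom m i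
  ≡⟨ binom-step j m i ⟩
    j * binom (suc m) (suc i) + 2 * m * binom (m ∸ 1) i
  ≡⟨ cong₂ (λ u w → j * u + 2 * m * w) (sym (basis-above-suc (suc m))) (sym (basis-above (suc j) (m ∸ 1) i)) ⟩
    j * basis j (suc m) (suc (j + i)) + 2 * m * basis (suc j) (m ∸ 1) (suc (j + i)) ∎
  where
  basis-above-suc : ∀ m′ → basis j m′ (suc (j + i)) ≡ binom m′ (suc i)
  basis-above-suc m′ = trans (cong (basis j m′) (sym (+-suc j i))) (basis-above j m′ (suc i))
... | below k<j with position j (suc k)
...   | below k+1<j rewrite basis-below j m (suc k) k+1<j | basis-below j m k k<j
          | basis-below j (suc m) (suc k) k+1<j | basis-below (suc j) (m ∸ 1) (suc k) (s≤s k<j)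
          | *-zeroʳ (suc k) | *-zeroʳ (m + 2 * j ∸ k) | *-zeroʳ j | *-zeroʳ (2 * m) = refl
...   | above i e with ≤-antisym (subst (j ≤_) (sym e) (m≤m+n j i)) k<j
...     | refl rewrite trans (cong (basis (suc k) m) (sym (+-identityʳ (suc k)))) (basis-above (suc k) m 0)
          | trans (cong (basis (suc k) (suc m)) (sym (+-identityʳ (suc k)))) (basis-above (suc k) (suc m) 0)
          | basis-below (suc k) m k (n<1+n k) | basis-below (suc (suc k)) (m ∸ 1) (suc k) (n<1+n (suc k))
          | *-zeroʳ (m + 2 * suc k ∸ k) | *-zeroʳ (2 * m) = refl

ΣR : ℕ → (ℕ → ℕ) → ℕ
ΣR zero f = 0
ΣR (suc R) f = f 0 + ΣR R (λ j → f (suc j))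

ΣR-cong : ∀ R {f g : ℕ → ℕ} → (∀ j → f j ≡ g j) → ΣR R f ≡ ΣR R g
ΣR-cong zero h = refl
ΣR-cong (suc R) h = cong₂ _+_ (h 0) (ΣR-cong R (λ j → h (suc j)))

ΣR-+ : ∀ R (f g : ℕ → ℕ) → ΣR R (λ j → f j + g j) ≡ ΣR R f + ΣR R g
ΣR-+ zero f g = refl
ΣR-+ (suc R) f g = trans (cong (f 0 + g 0 +_) (ΣR-+ R (λ j → f (suc j)) (λ j → g (suc j))))
                         (+-interchange (f 0) (g 0) (ΣR R (λ j → f (suc j))) (ΣR R (λ j → g (suc j))))

ΣR-scal : ∀ R c (f : ℕ → ℕ) → c * ΣR R f ≡ ΣR R (λ j → c * f j)
ΣR-scal zero c f = *-zeroʳ c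
ΣR-scal (suc R) c f = trans (*-distribˡ-+ c (f 0) _) (cong (c * f 0 +_) (ΣR-scal R c (λ j → f (suc j))))

ΣR-zero : ∀ R (f : ℕ → ℕ) → (∀ j → f j ≡ 0) → ΣR R f ≡ 0
ΣR-zero zero f h = refl
ΣR-zero (suc R) f h = cong₂ _+_ (h 0) (ΣR-zero R (λ j → f (suc j)) (λ j → h (suc j)))

ΣR-last : ∀ R (f : ℕ → ℕ) → ΣR (suc R) f ≡ ΣR R f + f R
ΣR-last zero f = +-identityʳ (f 0)
ΣR-last (suc R) f = trans (cong (f 0 +_) (ΣR-last R (λ j → f (suc j)))) (sym (+-assoc (f 0) _ _))

gammaSum : ℕ → (ℕ → ℕ) → ℕ → ℕ → ℕ
gammaSum n g R k = ΣR R (λ j → g j * basis j (n ∸ 2 * j) k)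

2*suc : ∀ j → 2 * suc j ≡ suc (suc (2 * j))
2*suc = solve-∀

exponent-suc : ∀ n j → 2 * suc j ≤ n → suc (n ∸ 2 * suc j) ≡ suc n ∸ 2 * suc j
exponent-suc n j le = sym (+-∸-assoc 1 le)

exponent-pred : ∀ n j → (n ∸ 2 * j) ∸ 1 ≡ suc n ∸ 2 * suc j
exponent-pred n j = trans (∸-+-assoc n (2 * j) 1) (trans (cong (n ∸_) (+-comm (2 * j) 1)) (cong (suc n ∸_) (sym (2*suc j))))

exponent-suc-suc : ∀ N j → N ∸ 2 * j ≡ suc (suc N) ∸ 2 * suc j
exponent-suc-suc N j = cong (suc (suc N) ∸_) (sym (2*suc j))

insertion-term : ∀ n (g : ℕ → ℕ) → (∀ j → n < 2 * j → g j ≡ 0) → ∀ j k →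
  suc k * (g j * basis j (n ∸ 2 * j) (suc k)) + (n ∸ k) * (g j * basis j (n ∸ 2 * j) k)
  ≡ g j * (j * basis j (suc (n ∸ 2 * j)) (suc k)) + g j * (2 * (n ∸ 2 * j) * basis (suc j) ((n ∸ 2 * j) ∸ 1) (suc k))
insertion-term n g g-vanish j k with n <? 2 * j
... | yes n<2j rewrite g-vanish j n<2j | *-zeroʳ (suc k) | *-zeroʳ (n ∸ k) = refl
... | no n≮2j = begin
    suc k * (g j * b (suc k)) + (n ∸ k) * (g j * b k)
  ≡⟨ factor (suc k) (g j) (b (suc k)) (n ∸ k) (b k) ⟩
    g j * (suc k * b (suc k) + (n ∸ k) * b k)
  ≡⟨ cong (λ z → g j * (suc k * b (suc k) + (z ∸ k) * b k)) (sym (m∸n+n≡m (≮⇒≥ n≮2j))) ⟩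
    g j * (suc k * b (suc k) + ((n ∸ 2 * j) + 2 * j ∸ k) * b k)
  ≡⟨ cong (g j *_) (basis-step j (n ∸ 2 * j) k) ⟩
    g j * (j * basis j (suc (n ∸ 2 * j)) (suc k) + 2 * (n ∸ 2 * j) * basis (suc j) ((n ∸ 2 * j) ∸ 1) (suc k))
  ≡⟨ *-distribˡ-+ (g j) _ _ ⟩
    g j * (j * basis j (suc (n ∸ 2 * j)) (suc k)) + g j * (2 * (n ∸ 2 * j) * basis (suc j) ((n ∸ 2 * j) ∸ 1) (suc k)) ∎
  where
  b : ℕ → ℕ
  b = basis j (n ∸ 2 * j)
  factor : ∀ a b c d e → a * (b * c) + d * (b * e) ≡ b * (a * c + d * e)
  factor = solve-∀

-- Applying the excedance-insertion operator f(k) ↦ (k+1) f(k+1) + (n-k) f(k)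
-- to a gamma expansion of center n/2 gives a gamma expansion of center (n+1)/2,
-- read off in degree k+1: by `basis-step` each t^j(1+t)^(n-2j) contributes
-- j t^j(1+t)^(n+1-2j) ("stay") and 2(n-2j) t^(j+1)(1+t)^(n-1-2j) ("raise").
insertion-step : ∀ n (g : ℕ → ℕ) → (∀ j → n < 2 * j → g j ≡ 0) → ∀ R → n ≤ 2 * R → ∀ k →
  suc k * gammaSum n g (suc R) (suc k) + (n ∸ k) * gammaSum n g (suc R) k
  ≡ ΣR R (λ j → (suc j * g (suc j) + 2 * (n ∸ 2 * j) * g j) * basis (suc j) (suc n ∸ 2 * suc j) (suc k))
insertion-step n g g-vanish R n≤2R k = begin
    suc k * ΣR (suc R) (λ j → g j * b j (suc k)) + (n ∸ k) * ΣR (suc R) (λ j → g j * b j k)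
  ≡⟨ cong₂ _+_ (ΣR-scal (suc R) (suc k) (λ j → g j * b j (suc k))) (ΣR-scal (suc R) (n ∸ k) (λ j → g j * b j k)) ⟩
    ΣR (suc R) (λ j → suc k * (g j * b j (suc k))) + ΣR (suc R) (λ j → (n ∸ k) * (g j * b j k))
  ≡⟨ sym (ΣR-+ (suc R) (λ j → suc k * (g j * b j (suc k))) (λ j → (n ∸ k) * (g j * b j k))) ⟩
    ΣR (suc R) (λ j → suc k * (g j * b j (suc k)) + (n ∸ k) * (g j * b j k))
  ≡⟨ trans (ΣR-cong (suc R) (λ j → insertion-term n g g-vanish j k)) (ΣR-+ (suc R) stay raise) ⟩
    ΣR (suc R) stay + ΣR (suc R) raise
  ≡⟨ cong₂ _+_ (cong (_+ ΣR R (λ j → stay (suc j))) (*-zeroʳ (g 0)))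
               (trans (ΣR-last R raise) (cong (ΣR R raise +_) raise-top)) ⟩
    ΣR R (λ j → stay (suc j)) + (ΣR R raise + 0)
  ≡⟨ cong₂ _+_ (ΣR-cong R stay-shift) (trans (+-identityʳ _) (ΣR-cong R raise-shift)) ⟩
    ΣR R (λ j → suc j * g (suc j) * B j) + ΣR R (λ j → 2 * (n ∸ 2 * j) * g j * B j)
  ≡⟨ sym (ΣR-+ R (λ j → suc j * g (suc j) * B j) (λ j → 2 * (n ∸ 2 * j) * g j * B j)) ⟩
    ΣR R (λ j → suc j * g (suc j) * B j + 2 * (n ∸ 2 * j) * g j * B j)
  ≡⟨ ΣR-cong R (λ j → sym (*-distribʳ-+ (B j) (suc j * g (suc j)) _)) ⟩
    ΣR R (λ j → (suc j * g (suc j) + 2 * (n ∸ 2 * j) * g j) * B j) ∎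
  where
  b : ℕ → ℕ → ℕ
  b j = basis j (n ∸ 2 * j)
  B stay raise : ℕ → ℕ
  B j = basis (suc j) (suc n ∸ 2 * suc j) (suc k)
  stay j = g j * (j * basis j (suc (n ∸ 2 * j)) (suc k))
  raise j = g j * (2 * (n ∸ 2 * j) * basis (suc j) ((n ∸ 2 * j) ∸ 1) (suc k))
  reassoc : ∀ a b c → a * (b * c) ≡ b * a * c
  reassoc = solve-∀
  raise-top : raise R ≡ 0
  raise-top = trans (cong (λ z → g R * (2 * z * basis (suc R) (z ∸ 1) (suc k))) (m≤n⇒m∸n≡0 n≤2R)) (*-zeroʳ (g R))
  stay-shift : ∀ j → stay (suc j) ≡ suc j * g (suc j) * B j
  stay-shift j with n <? 2 * suc j
  ... | yes n<2j+2 rewrite g-vanish (suc j) n<2j+2 | *-zeroʳ (suc j) = refl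
  ... | no n≮2j+2 = trans (cong (λ z → g (suc j) * (suc j * basis (suc j) z (suc k))) (exponent-suc n j (≮⇒≥ n≮2j+2)))
                          (reassoc (g (suc j)) (suc j) (B j))
  raise-shift : ∀ j → raise j ≡ 2 * (n ∸ 2 * j) * g j * B j
  raise-shift j = trans (cong (λ z → g j * (2 * (n ∸ 2 * j) * basis (suc j) z (suc k))) (exponent-pred n j))
                        (reassoc (g j) (2 * (n ∸ 2 * j)) (B j))

shift-step : ∀ N (g : ℕ → ℕ) R k →
  suc N * gammaSum N g R k ≡ ΣR R (λ j → suc N * g j * basis (suc j) (suc (suc N) ∸ 2 * suc j) (suc k))
shift-step N g R k = trans (ΣR-scal R (suc N) _) (ΣR-cong R term)
  where
  term : ∀ j → suc N * (g j * basis j (N ∸ 2 * j) k) ≡ suc N * g j * basis (suc j) (suc (suc N) ∸ 2 * suc j) (suc k)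
  term j = trans (sym (*-assoc (suc N) (g j) _))
                 (cong (suc N * g j *_) (trans (basis-shift j (N ∸ 2 * j) k) (cong (λ z → basis (suc j) z (suc k)) (exponent-suc-suc N j))))

-- The gamma coefficients, defined by the recurrence the signed derangement
-- numbers force on them (p records the required parity):
-- γ_{N+2,p}(j+1) = (j+1) γ_{N+1,¬p}(j+1) + 2(N+1-2j) γ_{N+1,¬p}(j) + (N+1) γ_{N,¬p}(j).
γ : ℕ → Bool → ℕ → ℕ
γ zero p zero = bit p
γ zero p (suc j) = 0
γ (suc zero) p j = 0
γ (suc (suc N)) p zero = 0
γ (suc (suc N)) p (suc j) = suc j * γ (suc N) (not p) (suc j) + 2 * (suc N ∸ 2 * j) * γ (suc N) (not p) j + suc N * γ N (not p) j

γ-vanish : ∀ n p j → n < 2 * j → γ n p j ≡ 0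
γ-vanish zero p zero ()
γ-vanish zero p (suc j) _ = refl
γ-vanish (suc zero) p j _ = refl
γ-vanish (suc (suc N)) p zero ()
γ-vanish (suc (suc N)) p (suc j) h = begin
    suc j * γ (suc N) (not p) (suc j) + 2 * (suc N ∸ 2 * j) * γ (suc N) (not p) j + suc N * γ N (not p) j
  ≡⟨ cong₂ (λ u w → suc j * u + w + suc N * γ N (not p) j) (γ-vanish (suc N) (not p) (suc j) (<-trans (n<1+n (suc N)) h)) middle ⟩
    suc j * 0 + 0 + suc N * γ N (not p) j
  ≡⟨ cong₂ (λ u w → u + 0 + suc N * w) (*-zeroʳ (suc j)) (γ-vanish N (not p) j N<2j) ⟩
    0 + 0 + suc N * 0
  ≡⟨ *-zeroʳ (suc N) ⟩
    0 ∎
  where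
  N<2j : N < 2 * j
  N<2j = s<s⁻¹ (s<s⁻¹ (subst (suc (suc N) <_) (2*suc j) h))
  middle : 2 * (suc N ∸ 2 * j) * γ (suc N) (not p) j ≡ 0
  middle with suc N <? 2 * j
  ... | yes l = trans (cong (2 * (suc N ∸ 2 * j) *_) (γ-vanish (suc N) (not p) j l)) (*-zeroʳ (2 * (suc N ∸ 2 * j)))
  ... | no _ = cong (λ z → 2 * z * γ (suc N) (not p) j) (m≤n⇒m∸n≡0 N<2j)

module GammaExpansion (a : ℕ → Bool → ℕ → ℕ)
  (a-0 : ∀ p k → a 0 p k ≡ bit p * basis 0 0 k)
  (a-1 : ∀ p k → a 1 p k ≡ 0)
  (a-const : ∀ N p → a (suc (suc N)) p 0 ≡ 0)
  (a-rec : ∀ N p k → a (suc (suc N)) p (suc k) ≡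
             suc k * a (suc N) (not p) (suc k) + (suc N ∸ k) * a (suc N) (not p) k + suc N * a N (not p) k)
  where

  gamma-expansion : ∀ n p R → n < 2 * R → ∀ k → a n p k ≡ gammaSum n (γ n p) R k
  gamma-expansion zero p zero () k
  gamma-expansion zero p (suc R) _ k =
    trans (a-0 p k) (sym (trans (cong (bit p * basis 0 0 k +_) (ΣR-zero R _ (λ j → refl))) (+-identityʳ _)))
  gamma-expansion (suc zero) p R _ k = trans (a-1 p k) (sym (ΣR-zero R _ (λ j → refl)))
  gamma-expansion (suc (suc N)) p R _ zero = trans (a-const N p) (sym (ΣR-zero R _ no-constant-term))
    where
    no-constant-term : ∀ j → γ (suc (suc N)) p j * basis j (suc (suc N) ∸ 2 * j) 0 ≡ 0
    no-constant-term zero = refl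
    no-constant-term (suc j) = trans (cong (γ (suc (suc N)) p (suc j) *_) (basis-below (suc j) (suc (suc N) ∸ 2 * suc j) 0 (s≤s z≤n)))
                                     (*-zeroʳ (γ (suc (suc N)) p (suc j)))
  gamma-expansion (suc (suc N)) p zero () (suc k)
  gamma-expansion (suc (suc N)) p (suc R) h (suc k) = begin
      a (suc (suc N)) p (suc k)
    ≡⟨ a-rec N p k ⟩
      suc k * a n q (suc k) + (n ∸ k) * a n q k + n * a N q k
    ≡⟨ cong₂ _+_ (cong₂ (λ u v → suc k * u + (n ∸ k) * v)
                   (gamma-expansion (suc N) (not p) (suc R) n<2R+2 (suc k)) (gamma-expansion (suc N) (not p) (suc R) n<2R+2 k))
                 (cong (n *_) (gamma-expansion N (not p) R N<2R k)) ⟩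
      suc k * gammaSum n (γ n q) (suc R) (suc k) + (n ∸ k) * gammaSum n (γ n q) (suc R) k + n * gammaSum N (γ N q) R k
    ≡⟨ cong₂ _+_ (insertion-step n (γ n q) (γ-vanish n q) R n≤2R k) (shift-step N (γ N q) R k) ⟩
      ΣR R (λ j → (suc j * γ n q (suc j) + 2 * (n ∸ 2 * j) * γ n q j) * B j) + ΣR R (λ j → n * γ N q j * B j)
    ≡⟨ sym (ΣR-+ R (λ j → (suc j * γ n q (suc j) + 2 * (n ∸ 2 * j) * γ n q j) * B j) (λ j → n * γ N q j * B j)) ⟩
      ΣR R (λ j → (suc j * γ n q (suc j) + 2 * (n ∸ 2 * j) * γ n q j) * B j + n * γ N q j * B j)
    ≡⟨ ΣR-cong R (λ j → sym (*-distribʳ-+ (B j) (suc j * γ n q (suc j) + 2 * (n ∸ 2 * j) * γ n q j) (n * γ N q j))) ⟩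
      gammaSum (suc (suc N)) (γ (suc (suc N)) p) (suc R) (suc k) ∎
    where
    n = suc N
    q = not p
    B : ℕ → ℕ
    B j = basis (suc j) (suc (suc N) ∸ 2 * suc j) (suc k)
    N<2R : N < 2 * R
    N<2R = s<s⁻¹ (s<s⁻¹ (subst (suc (suc N) <_) (2*suc R) h))
    n≤2R : n ≤ 2 * R
    n≤2R = N<2R
    n<2R+2 : n < 2 * suc R
    n<2R+2 = <-trans (n<1+n n) h

-- The signed derangement numbers satisfy the hypotheses of GammaExpansion.
-- Initial values: the empty permutation is an even derangement with no
-- excedance, and [1] has no derangement.
derCount-0 : ∀ p k → derCount 0 p k ≡ bit p * basis 0 0 k
derCount-0 true zero = refl
derCount-0 true (suc k) = refl
derCount-0 false zero = refl
derCount-0 false (suc k) = refl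

derCount-1 : ∀ p k → derCount 1 p k ≡ 0
derCount-1 p k = refl

derCount-const : ∀ N p → derCount (suc (suc N)) p 0 ≡ 0
derCount-const N p = trans (derSum-recurrence N Φ) (cong₂ _+_ (trans (derSum-cong (suc N) inserted) (derSum-0 (suc N)))
                                       (trans (cong (suc N *_) (trans (derSum-cong N shifted) (derSum-0 N))) (*-zeroʳ (suc N))))
  where
  Φ = λ e s → bit (matches p s) * ind (e ≟ 0)
  inserted : ∀ e s → e * Φ e (not s) + (suc N ∸ e) * Φ (suc e) (not s) ≡ 0
  inserted zero s = trans (cong ((suc N) *_) (*-zeroʳ (bit (matches p (not s))))) (*-zeroʳ (suc N))
  inserted (suc e) s rewrite *-zeroʳ (bit (matches p (not s))) | *-zeroʳ (suc e) | *-zeroʳ (suc N ∸ suc e) = refl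
  shifted : ∀ e s → Φ (suc e) (not s) ≡ 0
  shifted e s = *-zeroʳ (bit (matches p (not s)))

select-scale : ∀ e c y → e * (y * ind (e ≟ c)) ≡ c * (y * ind (e ≟ c))
select-scale e c y with e ≟ c
... | yes refl = refl
... | no _ rewrite *-zeroʳ y = trans (*-zeroʳ e) (sym (*-zeroʳ c))

derCount-rec : ∀ N p k → derCount (suc (suc N)) p (suc k) ≡
  suc k * derCount (suc N) (not p) (suc k) + (suc N ∸ k) * derCount (suc N) (not p) k + suc N * derCount N (not p) k
derCount-rec N p k = begin
    derCount (suc (suc N)) p (suc k)
  ≡⟨ derSum-recurrence N Φ ⟩
    derSum (suc N) (λ e s → e * Φ e (not s) + (suc N ∸ e) * Φ (suc e) (not s)) + suc N * derSum N (λ e s → Φ (suc e) (not s))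
  ≡⟨ cong₂ (λ u w → u + suc N * w) (derSum-cong (suc N) inserted) (derSum-cong N shifted) ⟩
    derSum (suc N) (λ e s → suc k * Φ′ (suc k) e s + (suc N ∸ k) * Φ′ k e s) + suc N * derCount N (not p) k
  ≡⟨ cong (_+ suc N * derCount N (not p) k)
       (trans (derSum-+ (suc N) (λ e s → suc k * Φ′ (suc k) e s) (λ e s → (suc N ∸ k) * Φ′ k e s))
              (cong₂ _+_ (derSum-scal (suc N) (suc k) (Φ′ (suc k))) (derSum-scal (suc N) (suc N ∸ k) (Φ′ k)))) ⟩
    suc k * derCount (suc N) (not p) (suc k) + (suc N ∸ k) * derCount (suc N) (not p) k + suc N * derCount N (not p) k ∎
  where
  Φ : ℕ → Bool → ℕ
  Φ e s = bit (matches p s) * ind (e ≟ suc k)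
  Φ′ : ℕ → ℕ → Bool → ℕ
  Φ′ c e s = bit (matches (not p) s) * ind (e ≟ c)
  shifted : ∀ e s → Φ (suc e) (not s) ≡ Φ′ k e s
  shifted e s = cong₂ _*_ (cong bit (matches-not p s)) (ind-iff (suc e ≟ suc k) (e ≟ k) suc-injective (cong suc))
  select-scale′ : ∀ e s → (suc N ∸ e) * Φ′ k e s ≡ (suc N ∸ k) * Φ′ k e s
  select-scale′ e s with e ≟ k
  ... | yes refl = refl
  ... | no _ rewrite *-zeroʳ (bit (matches (not p) s)) = trans (*-zeroʳ (suc N ∸ e)) (sym (*-zeroʳ (suc N ∸ k)))
  inserted : ∀ e s → e * Φ e (not s) + (suc N ∸ e) * Φ (suc e) (not s) ≡ suc k * Φ′ (suc k) e s + (suc N ∸ k) * Φ′ k e s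
  inserted e s = cong₂ _+_ (trans (cong (λ z → e * (bit z * ind (e ≟ suc k))) (matches-not p s))
                                  (select-scale e (suc k) (bit (matches (not p) s))))
                           (trans (cong ((suc N ∸ e) *_) (shifted e s)) (select-scale′ e s))

open GammaExpansion derCount derCount-0 derCount-1 derCount-const derCount-rec

gammaSum-+ : ∀ n (f g : ℕ → ℕ) R k → gammaSum n f R k + gammaSum n g R k ≡ gammaSum n (λ j → f j + g j) R k
gammaSum-+ n f g R k = trans (sym (ΣR-+ R _ _)) (ΣR-cong R (λ j → sym (*-distribʳ-+ (basis j (n ∸ 2 * j) k) (f j) (g j))))

derCount-gamma : ∀ n p k → derCount n p k ≡ gammaSum n (γ n p) (suc (n / 2)) k
derCount-gamma n p = gamma-expansion n p (suc (n / 2)) (bound n)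
  where
  bound : ∀ n → n < 2 * suc (n / 2)
  bound n = subst (_< 2 * suc (n / 2)) (sym (m≡m%n+[m/n]*n n 2))
    (subst (n % 2 + n / 2 * 2 <_) (arith (n / 2)) (+-monoˡ-< (n / 2 * 2) (m%n<n n 2)))
    where
    arith : ∀ q → 2 + q * 2 ≡ 2 * suc q
    arith = solve-∀

gammaPositive-intro : ∀ n (f c : ℕ → ℕ) → (∀ k → f k ≡ gammaSum n c (suc (n / 2)) k) → GammaPositive f n
gammaPositive-intro n f c h = c , λ k → trans (h k) (sym (sum-upTo (suc (n / 2)) (λ j → j) (λ j → c j * coeffGammaBasis j (n ∸ 2 * j) k)))
  where
  sum-upTo : ∀ R (g : ℕ → ℕ) (F : ℕ → ℕ) → sum (map F (applyUpTo g R)) ≡ ΣR R (λ j → F (g j))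
  sum-upTo zero g F = refl
  sum-upTo (suc R) g F = cong (F (g 0) +_) (sum-upTo R (λ j → g (suc j)) F)

theorem42 : (n : ℕ) → 1 Data.Nat.≤ n →
    GammaPositive (ADerExc n) n × GammaPositive (ADerExc⁺ n) n × GammaPositive (ADerExc⁻ n) n
theorem42 n _ =
    gammaPositive-intro n (ADerExc n) (λ j → γ n true j + γ n false j) (λ k → begin
        ADerExc n k
      ≡⟨ ADerExc-split n k ⟩
        derCount n true k + derCount n false k
      ≡⟨ cong₂ _+_ (derCount-gamma n true k) (derCount-gamma n false k) ⟩
        gammaSum n (γ n true) R k + gammaSum n (γ n false) R k
      ≡⟨ gammaSum-+ n (γ n true) (γ n false) R k ⟩
        gammaSum n (λ j → γ n true j + γ n false j) R k ∎)
  , gammaPositive-intro n (ADerExc⁺ n) (γ n true) (λ k → trans (ADerExc⁺≡derCount n k) (derCount-gamma n true k))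
  , gammaPositive-intro n (ADerExc⁻ n) (γ n false) (λ k → trans (ADerExc⁻≡derCount n k) (derCount-gamma n false k))
  where
  R = suc (n / 2)
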